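{- For every real $\alpha$ with $0<\alpha<1$ there exists a set $A\subseteq\mathbb{N}$ such that the asymptotic densities of $A$ and of $A^2$ exist and satisfy $\mathbf{d}A>\alpha$ and $\mathbf{d}(A^2)<\alpha$.
   Context: $\mathbb{N}$ is the set of positive integers, $A^2=\{ab: a,b\in A\}$, and $\mathbf{d}S=\lim_{n\to\infty}|S\cap[1,n]|/n$ is the asymptotic density. -}

module Defs where

open import Data.Bool using (Bool; T; if_then_else_)
open import Data.Nat as ℕ using (ℕ; zero; suc; s≤s)
open import Data.Nat.Properties using (m≤m*n; *-zeroʳ; *-comm)
open import Data.Fin using (Fin; toℕ; fromℕ<)
open import Data.Fin.Properties using (any?; toℕ-fromℕ<)
open import Data.Integer using (+_)
open import Data.Rational using (ℚ; 0ℚ; 1ℚ; _+_; _-_; ∣_∣; _≤_; _<_; _/_)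
open import Data.Rational.Properties using (+-inverseʳ; +-mono-≤; nonNegative⁻¹; normalize-nonNeg)
open import Data.Product using (Σ; ∃; _×_; _,_)
open import Relation.Nullary using (Dec; yes; no; does)
open import Relation.Nullary.Decidable using (_×-dec_; map′)
open import Relation.Nullary.Decidable.Core using (T?)
open import Relation.Unary using (Decidable)
open import Relation.Binary.PropositionalEquality using (_≡_; refl; sym; subst)

-- Subsets of ℕ are given by their (decidable) characteristic function.
-- Only the positive integers 1,2,3,… ever matter (counting starts at 1).

InSq : (ℕ → Bool) → ℕ → Set
InSq A m = Σ ℕ λ a → Σ ℕ λ b → T (A a) × T (A b) × a ℕ.* b ≡ m

private
  Bnd : (ℕ → Bool) → ℕ → Set
  Bnd A m = ∃ λ (a : Fin (suc m)) → ∃ λ (b : Fin (suc m)) →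
              T (A (toℕ a)) × T (A (toℕ b)) × toℕ a ℕ.* toℕ b ≡ m

  bnd? : ∀ A m → Dec (Bnd A m)
  bnd? A m = any? λ a → any? λ b →
    T? (A (toℕ a)) ×-dec (T? (A (toℕ b)) ×-dec (toℕ a ℕ.* toℕ b ℕ.≟ m))

  to : ∀ A m → Bnd A m → InSq A m
  to A m (a , b , p , q , e) = toℕ a , toℕ b , p , q , e

  le : ∀ a b n → a ℕ.* b ≡ suc n → a ℕ.≤ suc n
  le a zero n e with subst (_≡ suc n) (*-zeroʳ a) e
  ... | ()
  le a (suc b) n e = subst (a ℕ.≤_) e (m≤m*n a (suc b))

  from : ∀ A n → InSq A (suc n) → Bnd A (suc n)
  from A n (a , b , p , q , e) =
    fromℕ< la , fromℕ< lb ,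
    subst (λ x → T (A x)) (sym (toℕ-fromℕ< la)) p ,
    subst (λ x → T (A x)) (sym (toℕ-fromℕ< lb)) q ,
    fix (toℕ-fromℕ< la) (toℕ-fromℕ< lb)
    where
    la = s≤s (le a b n e)
    lb = s≤s (le b a n (subst (_≡ suc n) (*-comm a b) e))
    fix : ∀ {x y} → x ≡ a → y ≡ b → x ℕ.* y ≡ suc n
    fix refl refl = e

InSq? : (A : ℕ → Bool) → Decidable (λ n → InSq A (suc n))
InSq? A n = map′ (to A (suc n)) (from A n) (bnd? A (suc n))

-- counting:  count P P? n = |{ i ∈ [1,n] : P i }|,  where P? decides P on positive integers
count : (P : ℕ → Set) → Decidable (λ n → P (suc n)) → ℕ → ℕ
count P P? zero = zero
count P P? (suc n) = (if does (P? n) then 1 else 0) ℕ.+ count P P? n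

ratio : (P : ℕ → Set) → Decidable (λ n → P (suc n)) → ℕ → ℚ
ratio P P? n = + count P P? (suc n) / suc n

-- Real numbers (Bishop): regular Cauchy sequences of rationals.
-- inv n = 1/(n+1); x n approximates x to within inv n.
inv : ℕ → ℚ
inv n = + 1 / suc n

record ℝ : Set where
  field
    seq : ℕ → ℚ
    reg : ∀ m n → ∣ seq m - seq n ∣ ≤ inv m + inv n
open ℝ public

_<ℝ_ : ℝ → ℝ → Set
x <ℝ y = ∃ λ n → seq x n + inv n + inv n < seq y n

private
  0≤inv : ∀ n → 0ℚ ≤ inv n
  0≤inv n = nonNegative⁻¹ (inv n) {{normalize-nonNeg 1 (suc n)}}

  ∣q-q∣≤ : ∀ (q : ℚ) m n → ∣ q - q ∣ ≤ inv m + inv n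
  ∣q-q∣≤ q m n rewrite +-inverseʳ q = +-mono-≤ (0≤inv m) (0≤inv n)

const : ℚ → ℝ
const q = record { seq = λ _ → q ; reg = ∣q-q∣≤ q }

0ℝ 1ℝ : ℝ
0ℝ = const 0ℚ
1ℝ = const 1ℚ

-- convergence of a rational sequence s to a real x:
-- for every k there is N with |s n - x| ≤ 1/(k+1) for all n ≥ N
-- (expressed through the approximants:  |s n - x m| ≤ inv k + inv m for all m)
_⟶_ : (ℕ → ℚ) → ℝ → Set
s ⟶ x = ∀ k → ∃ λ N → ∀ n → N ℕ.≤ n → ∀ m → ∣ s n - seq x m ∣ ≤ inv k + inv m

HasDensity : (P : ℕ → Set) → Decidable (λ n → P (suc n)) → ℝ → Set
HasDensity P P? d = ratio P P? ⟶ d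

Mem : (ℕ → Bool) → ℕ → Set
Mem A n = T (A n)

Mem? : (A : ℕ → Bool) → Decidable (λ n → Mem A (suc n))
Mem? A n = T? (A (suc n))

-- For α < ½ take the multiples of some s: they have density 1/s and their square set, the
-- multiples of s², has density 1/s²; consecutive intervals (1/s², 1/s) overlap and cover (0, ½).
-- For α ≥ ½ take the integers with a prime factor p ≤ k: density 1 - ρ k with ρ k = ∏_{p ≤ k} (1 - 1/p).
-- Their square set misses exactly the products p c with c free of primes ≤ k, so it has density
-- 1 - ρ k - ρ k Σ_{p ≤ k} 1/p.  Since Σ_{p ≤ k} 1/p ≥ 5/6 for k ≥ 3 these intervals overlap too,
-- and the dilates s · (k-rough numbers), 1 ≤ s ≤ k, are disjoint, so ρ k · H k ≤ 1 and ρ k → 0.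
-- All densities hold with bounded error.  Finally, the witnesses of 0 < α < 1 confine the rational
-- approximations of α to a window [1/(lo+1), 1 - 1/(hi+1)] on which the required margin is
-- uniform, so a fine enough approximation selects the set.

module Submission where

open import Defs
open import Data.Bool using (Bool; true; false; _∧_; _∨_; not; if_then_else_; T)
import Data.Bool.Properties as 𝔹
open import Data.Empty using (⊥; ⊥-elim)
open import Data.Integer as ℤ using (+_; +[1+_]; -[1+_])
import Data.Integer.Properties as ℤP
open import Data.Nat as ℕ using (ℕ; zero; suc; z≤n; s≤s)
import Data.Nat.Properties as ℕP
import Data.Nat.DivMod as ℕ
open import Data.Nat.Divisibility using (_∣_; _∣?_; ∣-refl; ∣-trans; n∣m*n; ∣m⇒∣m*n; ∣n⇒∣m*n; ∣⇒≤; ∣-antisym; *-pres-∣; *-cancelˡ-∣; ∣m+n∣m⇒∣n; m*n∣o⇒n∣o/m; m*n∣⇒m∣; 0∣⇒≡0)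
open import Data.Nat.Coprimality using (Coprime; coprime-divisor)
open import Data.Nat.Induction using (<-rec)
open import Data.Product using (Σ; _×_; _,_; proj₁; proj₂)
open import Data.Rational
  using (ℚ; mkℚ; 0ℚ; 1ℚ; ½; _+_; _*_; _-_; -_; ∣_∣; _≤_; _<_; _/_; _≤?_; _<?_; ↥_; toℚᵘ; *≤*; *<*; nonNegative; positive)
open import Data.Rational.Properties
import Data.Rational.Unnormalised as ℚᵘ
import Data.Rational.Unnormalised.Properties as ℚᵘP
open import Data.Rational.Solver using (module +-*-Solver)
open import Data.Sum using (_⊎_; inj₁; inj₂)
open import Relation.Nullary using (Dec; yes; no; does; ¬_)
open import Relation.Nullary.Decidable using (dec-true; dec-false; toWitness; toWitnessFalse)
open import Relation.Unary using (Decidable)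
open import Relation.Binary.PropositionalEquality
open +-*-Solver using (solve; _:=_; _:+_; _:*_; _:-_; :-_; con)

0≤q-p : ∀ {p q} → p ≤ q → 0ℚ ≤ q - p
0≤q-p {p} {q} p≤q = begin
  0ℚ    ≡⟨ sym (+-inverseʳ p) ⟩
  p - p ≤⟨ +-monoˡ-≤ (- p) p≤q ⟩
  q - p ∎
  where open ≤-Reasoning

0<q-p : ∀ {p q} → p < q → 0ℚ < q - p
0<q-p {p} {q} p<q = begin-strict
  0ℚ    ≡⟨ sym (+-inverseʳ p) ⟩
  p - p <⟨ +-monoˡ-< (- p) p<q ⟩
  q - p ∎
  where open ≤-Reasoning

0≤q-p⇒p≤q : ∀ {p q} → 0ℚ ≤ q - p → p ≤ q
0≤q-p⇒p≤q {p} {q} h = begin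
  p            ≡⟨ sym (+-identityʳ p) ⟩
  p + 0ℚ       ≤⟨ +-monoʳ-≤ p h ⟩
  p + (q - p)  ≡⟨ solve 2 (λ p q → p :+ (q :- p) := q) refl p q ⟩
  q            ∎
  where open ≤-Reasoning

0<q-p⇒p<q : ∀ {p q} → 0ℚ < q - p → p < q
0<q-p⇒p<q {p} {q} h = begin-strict
  p            ≡⟨ sym (+-identityʳ p) ⟩
  p + 0ℚ       <⟨ +-monoʳ-< p h ⟩
  p + (q - p)  ≡⟨ solve 2 (λ p q → p :+ (q :- p) := q) refl p q ⟩
  q            ∎
  where open ≤-Reasoning

0≤p+q : ∀ {p q} → 0ℚ ≤ p → 0ℚ ≤ q → 0ℚ ≤ p + q
0≤p+q {p} {q} 0≤p 0≤q = subst (_≤ p + q) (+-identityʳ 0ℚ) (+-mono-≤ 0≤p 0≤q)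

0≤p*q : ∀ {p q} → 0ℚ ≤ p → 0ℚ ≤ q → 0ℚ ≤ p * q
0≤p*q {p} {q} 0≤p 0≤q = nonNegative⁻¹ (p * q) {{nonNeg*nonNeg⇒nonNeg p {{nonNegative 0≤p}} q {{nonNegative 0≤q}}}}

0<p*q : ∀ {p q} → 0ℚ < p → 0ℚ < q → 0ℚ < p * q
0<p*q {p} {q} 0<p 0<q = positive⁻¹ (p * q) {{pos*pos⇒pos p {{positive 0<p}} q {{positive 0<q}}}}

p≤∣p∣ : ∀ p → p ≤ ∣ p ∣
p≤∣p∣ p with 0ℚ ≤? p
... | yes 0≤p = ≤-reflexive (sym (0≤p⇒∣p∣≡p 0≤p))
... | no  0≰p = ≤-trans (<⇒≤ (≰⇒> 0≰p)) (0≤∣p∣ p)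

-p≤∣p∣ : ∀ p → - p ≤ ∣ p ∣
-p≤∣p∣ p = subst (- p ≤_) (∣-p∣≡∣p∣ p) (p≤∣p∣ (- p))

∣p-q∣≤r⇒q≤p+r : ∀ p q r → ∣ p - q ∣ ≤ r → q ≤ p + r
∣p-q∣≤r⇒q≤p+r p q r h = 0≤q-p⇒p≤q (subst (0ℚ ≤_)
  (solve 3 (λ p q r → r :- (:- (p :- q)) := (p :+ r) :- q) refl p q r)
  (0≤q-p (≤-trans (-p≤∣p∣ (p - q)) h)))

∣p-q∣≤r⇒p≤q+r : ∀ p q r → ∣ p - q ∣ ≤ r → p ≤ q + r
∣p-q∣≤r⇒p≤q+r p q r h = 0≤q-p⇒p≤q (subst (0ℚ ≤_)
  (solve 3 (λ p q r → r :- (p :- q) := (q :+ r) :- p) refl p q r)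
  (0≤q-p (≤-trans (p≤∣p∣ (p - q)) h)))

toℚᵘ-/ : ∀ i d → toℚᵘ (i / suc d) ℚᵘ.≃ ℚᵘ.mkℚᵘ i d
toℚᵘ-/ i d = toℚᵘ-fromℚᵘ (ℚᵘ.mkℚᵘ i d)

cross-≤ : ∀ a b c d → a ℤ.* + suc d ℤ.≤ c ℤ.* + suc b → a / suc b ≤ c / suc d
cross-≤ a b c d h = toℚᵘ-cancel-≤
  (ℚᵘP.≤-respʳ-≃ (ℚᵘP.≃-sym (toℚᵘ-/ c d)) (ℚᵘP.≤-respˡ-≃ (ℚᵘP.≃-sym (toℚᵘ-/ a b)) (ℚᵘ.*≤* h)))

cross-< : ∀ a b c d → a ℤ.* + suc d ℤ.< c ℤ.* + suc b → a / suc b < c / suc d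
cross-< a b c d h = toℚᵘ-cancel-<
  (ℚᵘP.<-respʳ-≃ (ℚᵘP.≃-sym (toℚᵘ-/ c d)) (ℚᵘP.<-respˡ-≃ (ℚᵘP.≃-sym (toℚᵘ-/ a b)) (ℚᵘ.*<* h)))

cross-≃ᵘ : ∀ a b c d → a ℤ.* + suc d ≡ c ℤ.* + suc b → toℚᵘ (a / suc b) ℚᵘ.≃ ℚᵘ.mkℚᵘ c d
cross-≃ᵘ a b c d h = ℚᵘP.≃-trans (toℚᵘ-/ a b) (ℚᵘ.*≡* h)

-- recip n = inv n = 1/(n + 1).  Both casts are opaque: on symbolic arguments their unfoldings
-- are gcd computations that type checking would otherwise try to normalise.
opaque
  fromℕ : ℕ → ℚ
  fromℕ n = + n / 1

  recip : ℕ → ℚ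
  recip n = + 1 / suc n

  fromℕ-lit : ∀ n → fromℕ n ≡ + n / 1
  fromℕ-lit n = refl

  recip-lit : ∀ n → recip n ≡ + 1 / suc n
  recip-lit n = refl

  recip≡inv : ∀ n → recip n ≡ inv n
  recip≡inv n = refl

  fromℕ-+ : ∀ m n → fromℕ (m ℕ.+ n) ≡ fromℕ m + fromℕ n
  fromℕ-+ m n = toℚᵘ-injective (ℚᵘP.≃-trans (cross-≃ᵘ (+ (m ℕ.+ n)) 0 _ _ e)
    (ℚᵘP.≃-sym (ℚᵘP.≃-trans (toℚᵘ-homo-+ (fromℕ m) (fromℕ n)) (ℚᵘP.+-cong (toℚᵘ-/ (+ m) 0) (toℚᵘ-/ (+ n) 0)))))
    where
    e : + (m ℕ.+ n) ℤ.* + 1 ≡ (+ m ℤ.* + 1 ℤ.+ + n ℤ.* + 1) ℤ.* + 1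
    e rewrite ℤP.*-identityʳ (+ m) | ℤP.*-identityʳ (+ n) | ℤP.*-identityʳ (+ m ℤ.+ + n) = ℤP.pos-+ m n

  fromℕ-* : ∀ m n → fromℕ (m ℕ.* n) ≡ fromℕ m * fromℕ n
  fromℕ-* m n = toℚᵘ-injective (ℚᵘP.≃-trans (cross-≃ᵘ (+ (m ℕ.* n)) 0 _ _ e)
    (ℚᵘP.≃-sym (ℚᵘP.≃-trans (toℚᵘ-homo-* (fromℕ m) (fromℕ n)) (ℚᵘP.*-cong (toℚᵘ-/ (+ m) 0) (toℚᵘ-/ (+ n) 0)))))
    where
    e : + (m ℕ.* n) ℤ.* + 1 ≡ (+ m ℤ.* + n) ℤ.* + 1
    e rewrite ℤP.*-identityʳ (+ m ℤ.* + n) | ℤP.*-identityʳ (+ (m ℕ.* n)) = ℤP.pos-* m n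

  fromℕ-mono-≤ : ∀ {m n} → m ℕ.≤ n → fromℕ m ≤ fromℕ n
  fromℕ-mono-≤ {m} {n} h = cross-≤ (+ m) 0 (+ n) 0
    (subst₂ ℤ._≤_ (sym (ℤP.*-identityʳ (+ m))) (sym (ℤP.*-identityʳ (+ n))) (ℤ.+≤+ h))

  fromℕ-mono-< : ∀ {m n} → m ℕ.< n → fromℕ m < fromℕ n
  fromℕ-mono-< {m} {n} h = cross-< (+ m) 0 (+ n) 0
    (subst₂ ℤ._<_ (sym (ℤP.*-identityʳ (+ m))) (sym (ℤP.*-identityʳ (+ n))) (ℤ.+<+ h))

  0≤fromℕ : ∀ n → 0ℚ ≤ fromℕ n
  0≤fromℕ n = nonNegative⁻¹ (fromℕ n) {{normalize-nonNeg n 1}}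

  ∣p∣≤fromℕ∣↥p∣ : ∀ p → ∣ p ∣ ≤ fromℕ ℤ.∣ ↥ p ∣
  ∣p∣≤fromℕ∣↥p∣ (mkℚ n d _) = toℚᵘ-cancel-≤ (ℚᵘP.≤-respʳ-≃ (ℚᵘP.≃-sym (toℚᵘ-/ (+ ℤ.∣ n ∣) 0)) (ℚᵘ.*≤*
    (subst₂ ℤ._≤_ (ℤP.pos-* ℤ.∣ n ∣ 1) (ℤP.pos-* ℤ.∣ n ∣ (suc d)) (ℤ.+≤+ (ℕP.*-monoʳ-≤ ℤ.∣ n ∣ (s≤s z≤n))))))

  /-as-* : ∀ a b → + a / suc b ≡ fromℕ a * recip b
  /-as-* a b = toℚᵘ-injective (ℚᵘP.≃-trans (cross-≃ᵘ (+ a) b _ _ e)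
    (ℚᵘP.≃-sym (ℚᵘP.≃-trans (toℚᵘ-homo-* (fromℕ a) (recip b)) (ℚᵘP.*-cong (toℚᵘ-/ (+ a) 0) (toℚᵘ-/ (+ 1) b)))))
    where
    e : + a ℤ.* + suc (b ℕ.+ 0 ℕ.* b) ≡ (+ a ℤ.* + 1) ℤ.* + suc b
    e rewrite ℤP.*-identityʳ (+ a) | ℕP.+-identityʳ b = refl

  fromℕ-suc*recip : ∀ n → fromℕ (suc n) * recip n ≡ 1ℚ
  fromℕ-suc*recip n = trans (sym (/-as-* (suc n) n)) (toℚᵘ-injective (cross-≃ᵘ (+ suc n) n (+ 1) 0 e))
    where
    e : + suc n ℤ.* + 1 ≡ + 1 ℤ.* + suc n
    e = trans (ℤP.*-identityʳ (+ suc n)) (sym (ℤP.*-identityˡ (+ suc n)))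

  0<recip : ∀ n → 0ℚ < recip n
  0<recip n = cross-< (+ 0) 0 (+ 1) n (ℤ.+<+ (s≤s z≤n))

  recip-antimono-≤ : ∀ {m n} → m ℕ.≤ n → recip n ≤ recip m
  recip-antimono-≤ h = cross-≤ (+ 1) _ (+ 1) _
    (subst₂ ℤ._≤_ (sym (ℤP.*-identityˡ _)) (sym (ℤP.*-identityˡ _)) (ℤ.+≤+ (s≤s h)))

  recip-antimono-< : ∀ {m n} → m ℕ.< n → recip n < recip m
  recip-antimono-< h = cross-< (+ 1) _ (+ 1) _
    (subst₂ ℤ._<_ (sym (ℤP.*-identityˡ _)) (sym (ℤP.*-identityˡ _)) (ℤ.+<+ (s≤s h)))

  archimedean : ∀ p → 0ℚ < p → Σ ℕ λ n → recip n < p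
  archimedean (mkℚ +[1+ a ] d c) _ = suc d ,
    toℚᵘ-cancel-< (ℚᵘP.<-respˡ-≃ (ℚᵘP.≃-sym (toℚᵘ-/ (+ 1) (suc d))) (ℚᵘ.*<* (subst₂ ℤ._<_ (ℤP.pos-* 1 (suc d)) (ℤP.pos-* (suc a) (suc (suc d)))
      (ℤ.+<+ (ℕP.≤-trans (s≤s (ℕP.≤-reflexive (ℕP.*-identityˡ (suc d)))) (ℕP.m≤m+n (suc (suc d)) (a ℕ.* suc (suc d))))))))
  archimedean (mkℚ (+ zero) d c) (*<* (ℤ.+<+ ()))
  archimedean (mkℚ -[1+ a ] d c) (*<* ())

fromℕ-suc : ∀ n → fromℕ (suc n) ≡ fromℕ n + 1ℚ
fromℕ-suc n = trans (cong fromℕ (ℕP.+-comm 1 n)) (trans (fromℕ-+ n 1) (cong (λ z → fromℕ n + z) (fromℕ-lit 1)))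

fromℕ-0 : fromℕ 0 ≡ 0ℚ
fromℕ-0 = fromℕ-lit 0

recip-0 : recip 0 ≡ 1ℚ
recip-0 = recip-lit 0

recip-1 : recip 1 ≡ ½
recip-1 = recip-lit 1

0≤recip : ∀ n → 0ℚ ≤ recip n
0≤recip n = <⇒≤ (0<recip n)

-- recip (mulIndex c n) = recip n / (c + 1), since suc (mulIndex c n) = (c + 1) * (n + 1).
mulIndex : ℕ → ℕ → ℕ
mulIndex c n = n ℕ.+ c ℕ.* suc n

fromℕ-suc*recip-mulIndex : ∀ c n → fromℕ (suc c) * recip (mulIndex c n) ≡ recip n
fromℕ-suc*recip-mulIndex c n = begin
  fromℕ (suc c) * i                           ≡⟨ sym (*-identityʳ _) ⟩
  fromℕ (suc c) * i * 1ℚ                      ≡⟨ cong (fromℕ (suc c) * i *_) (sym (trans (*-comm (recip n) _) (fromℕ-suc*recip n))) ⟩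
  fromℕ (suc c) * i * (recip n * fromℕ (suc n))   ≡⟨ solve 4 (λ a b c d → a :* b :* (c :* d) := c :* ((a :* d) :* b)) refl (fromℕ (suc c)) i (recip n) (fromℕ (suc n)) ⟩
  recip n * ((fromℕ (suc c) * fromℕ (suc n)) * i) ≡⟨ cong (λ z → recip n * (z * i)) (sym (fromℕ-* (suc c) (suc n))) ⟩
  recip n * (fromℕ (suc (mulIndex c n)) * i)    ≡⟨ cong (recip n *_) (fromℕ-suc*recip (mulIndex c n)) ⟩
  recip n * 1ℚ                                  ≡⟨ *-identityʳ (recip n) ⟩
  recip n                                       ∎
  where
  open ≡-Reasoning
  i = recip (mulIndex c n)

-- Counting and densities with bounded error

-- Sets of positive integers are Boolean predicates on ℕ whose value at 0 is ignored.
⟦_⟧ : Bool → ℕ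
⟦ true ⟧  = 1
⟦ false ⟧ = 0

card : (ℕ → Bool) → ℕ → ℕ
card S zero    = zero
card S (suc n) = ⟦ S (suc n) ⟧ ℕ.+ card S n

_∩_ _∖_ _∪_ : (ℕ → Bool) → (ℕ → Bool) → ℕ → Bool
(S ∩ T) n = S n ∧ T n
(S ∖ T) n = S n ∧ not (T n)
(S ∪ T) n = S n ∨ T n

∨≡true⇒ : ∀ a {b} → a ∨ b ≡ true → a ≡ true ⊎ b ≡ true
∨≡true⇒ true  _ = inj₁ refl
∨≡true⇒ false h = inj₂ h

contradictionᵇ : ∀ {b} → b ≡ true → not b ≡ true → ⊥
contradictionᵇ refl ()

card-cong : ∀ {S T} → (∀ n → S (suc n) ≡ T (suc n)) → ∀ n → card S n ≡ card T n
card-cong h zero    = refl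
card-cong h (suc n) = cong₂ ℕ._+_ (cong ⟦_⟧ (h n)) (card-cong h n)

card≤n : ∀ S n → card S n ℕ.≤ n
card≤n S zero = z≤n
card≤n S (suc n) with S (suc n)
... | true  = s≤s (card≤n S n)
... | false = ℕP.m≤n⇒m≤1+n (card≤n S n)

card-∩-∖ : ∀ S T n → card S n ≡ card (S ∩ T) n ℕ.+ card (S ∖ T) n
card-∩-∖ S T zero = refl
card-∩-∖ S T (suc n) rewrite card-∩-∖ S T n = split (S (suc n)) (T (suc n))
  where
  split : ∀ a b → ⟦ a ⟧ ℕ.+ (card (S ∩ T) n ℕ.+ card (S ∖ T) n)
                ≡ ⟦ a ∧ b ⟧ ℕ.+ card (S ∩ T) n ℕ.+ (⟦ a ∧ not b ⟧ ℕ.+ card (S ∖ T) n)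
  split true  true  = refl
  split true  false = sym (ℕP.+-suc (card (S ∩ T) n) (card (S ∖ T) n))
  split false b     = refl

record HasDensityᵇ (S : ℕ → Bool) (r : ℚ) : Set where
  constructor density
  field
    error : ℕ
    error-bound : ∀ n → ∣ fromℕ (card S n) - r * fromℕ n ∣ ≤ fromℕ error

open HasDensityᵇ

HasDensityᵇ-cong : ∀ {S T r} → (∀ n → S (suc n) ≡ T (suc n)) → HasDensityᵇ S r → HasDensityᵇ T r
HasDensityᵇ-cong {r = r} h (density E bound) =
  density E λ n → subst (λ c → ∣ fromℕ c - r * fromℕ n ∣ ≤ fromℕ E) (card-cong h n) (bound n)

univ-density : HasDensityᵇ (λ _ → true) 1ℚ
univ-density = density 0 λ n → ≤-reflexive (trans (cong ∣_∣ (trans (cong₂ _-_ (cong fromℕ (card-univ n)) (*-identityˡ (fromℕ n))) (+-inverseʳ (fromℕ n)))) (sym fromℕ-0))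
  where
  card-univ : ∀ n → card (λ _ → true) n ≡ n
  card-univ zero    = refl
  card-univ (suc n) = cong suc (card-univ n)

empty-density : HasDensityᵇ (λ _ → false) 0ℚ
empty-density = density 0 λ n → ≤-reflexive (trans (cong ∣_∣ (trans (cong₂ _-_ (trans (cong fromℕ (card-empty n)) fromℕ-0) (*-zeroˡ (fromℕ n))) (+-inverseʳ 0ℚ))) (sym fromℕ-0))
  where
  card-empty : ∀ n → card (λ _ → false) n ≡ 0
  card-empty zero    = refl
  card-empty (suc n) = card-empty n

∩-∖-density : ∀ {S T r r′} → HasDensityᵇ (S ∩ T) r → HasDensityᵇ (S ∖ T) r′ → HasDensityᵇ S (r + r′)
∩-∖-density {S} {T} {r} {r′} (density E bound) (density E′ bound′) = density (E ℕ.+ E′) bound″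
  where
  bound″ : ∀ n → ∣ fromℕ (card S n) - (r + r′) * fromℕ n ∣ ≤ fromℕ (E ℕ.+ E′)
  bound″ n = begin
    ∣ fromℕ (card S n) - (r + r′) * x ∣         ≡⟨ cong (λ k → ∣ fromℕ k - (r + r′) * x ∣) (card-∩-∖ S T n) ⟩
    ∣ fromℕ (c ℕ.+ c′) - (r + r′) * x ∣        ≡⟨ cong (λ q → ∣ q - (r + r′) * x ∣) (fromℕ-+ c c′) ⟩
    ∣ (fromℕ c + fromℕ c′) - (r + r′) * x ∣     ≡⟨ cong ∣_∣ (solve 5 (λ a b x r s → (a :+ b) :- (r :+ s) :* x := (a :- r :* x) :+ (b :- s :* x)) refl (fromℕ c) (fromℕ c′) x r r′) ⟩
    ∣ (fromℕ c - r * x) + (fromℕ c′ - r′ * x) ∣ ≤⟨ ∣p+q∣≤∣p∣+∣q∣ (fromℕ c - r * x) (fromℕ c′ - r′ * x) ⟩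
    ∣ fromℕ c - r * x ∣ + ∣ fromℕ c′ - r′ * x ∣ ≤⟨ +-mono-≤ (bound n) (bound′ n) ⟩
    fromℕ E + fromℕ E′                          ≡⟨ sym (fromℕ-+ E E′) ⟩
    fromℕ (E ℕ.+ E′)                            ∎
    where
    open ≤-Reasoning
    c = card (S ∩ T) n
    c′ = card (S ∖ T) n
    x = fromℕ n

∖-density : ∀ {S T r r′} → HasDensityᵇ S r → HasDensityᵇ (S ∩ T) r′ → HasDensityᵇ (S ∖ T) (r - r′)
∖-density {S} {T} {r} {r′} (density E bound) (density E′ bound′) = density (E ℕ.+ E′) bound″
  where
  bound″ : ∀ n → ∣ fromℕ (card (S ∖ T) n) - (r - r′) * fromℕ n ∣ ≤ fromℕ (E ℕ.+ E′)
  bound″ n = begin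
    ∣ fromℕ c′ - (r - r′) * x ∣                              ≡⟨ cong ∣_∣ (solve 5 (λ a b x r s → b :- (r :- s) :* x := ((a :+ b) :- r :* x) :- (a :- s :* x)) refl (fromℕ c) (fromℕ c′) x r r′) ⟩
    ∣ ((fromℕ c + fromℕ c′) - r * x) - (fromℕ c - r′ * x) ∣ ≡⟨ cong (λ q → ∣ (q - r * x) - (fromℕ c - r′ * x) ∣) (sym (fromℕ-+ c c′)) ⟩
    ∣ (fromℕ (c ℕ.+ c′) - r * x) - (fromℕ c - r′ * x) ∣    ≡⟨ cong (λ k → ∣ (fromℕ k - r * x) - (fromℕ c - r′ * x) ∣) (sym (card-∩-∖ S T n)) ⟩
    ∣ (fromℕ (card S n) - r * x) - (fromℕ c - r′ * x) ∣    ≤⟨ ∣p-q∣≤∣p∣+∣q∣ (fromℕ (card S n) - r * x) (fromℕ c - r′ * x) ⟩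
    ∣ fromℕ (card S n) - r * x ∣ + ∣ fromℕ c - r′ * x ∣    ≤⟨ +-mono-≤ (bound n) (bound′ n) ⟩
    fromℕ E + fromℕ E′                                    ≡⟨ sym (fromℕ-+ E E′) ⟩
    fromℕ (E ℕ.+ E′)                                      ∎
    where
    open ≤-Reasoning
    c = card (S ∩ T) n
    c′ = card (S ∖ T) n
    x = fromℕ n

∪-density : ∀ {S T r r′} → (∀ n → S n ≡ true → T n ≡ false) →
            HasDensityᵇ S r → HasDensityᵇ T r′ → HasDensityᵇ (S ∪ T) (r + r′)
∪-density {S} {T} disjoint dS dT = ∩-∖-density {S ∪ T} {S}
  (HasDensityᵇ-cong (λ n → sym (∪-∩-left (S (suc n)) (T (suc n)))) dS)
  (HasDensityᵇ-cong (λ n → sym (∪-∖-left (S (suc n)) (T (suc n)) (disjoint (suc n)))) dT)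
  where
  ∪-∩-left : ∀ a b → (a ∨ b) ∧ a ≡ a
  ∪-∩-left true  b = refl
  ∪-∩-left false b = 𝔹.∧-zeroʳ b
  ∪-∖-left : ∀ a b → (a ≡ true → b ≡ false) → (a ∨ b) ∧ not a ≡ b
  ∪-∖-left true  b h = sym (h refl)
  ∪-∖-left false b _ = 𝔹.∧-identityʳ b

complement-density : ∀ {S r} → HasDensityᵇ S r → HasDensityᵇ (λ n → not (S n)) (1ℚ - r)
complement-density {S} dS = ∖-density {λ _ → true} {S} univ-density (HasDensityᵇ-cong (λ _ → refl) dS)

density≤1 : ∀ {S r} → HasDensityᵇ S r → r ≤ 1ℚ
density≤1 {S} {r} (density E bound) with r ≤? 1ℚ
... | yes r≤1 = r≤1
... | no  r≰1 = ⊥-elim (<-irrefl refl (begin-strict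
    x + fromℕ E                ≡⟨ +-comm x (fromℕ E) ⟩
    fromℕ E + x                <⟨ +-monoˡ-< x (fromℕ-mono-< (ℕP.n<1+n E)) ⟩
    fromℕ (suc E) + x          ≡⟨ cong (_+ x) E+1≡x*recipN ⟩
    x * recip N + x              <⟨ +-monoˡ-< x (*-monoʳ-<-pos x {{positive 0<x}} recipN<r-1) ⟩
    x * (r - 1ℚ) + x           ≡⟨ solve 2 (λ x r → x :* (r :- con 1ℚ) :+ x := r :* x) refl x r ⟩
    r * x                      ≤⟨ ∣p-q∣≤r⇒q≤p+r (fromℕ (card S n)) (r * x) (fromℕ E) (bound n) ⟩
    fromℕ (card S n) + fromℕ E ≤⟨ +-monoˡ-≤ (fromℕ E) (fromℕ-mono-≤ (card≤n S n)) ⟩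
    x + fromℕ E                ∎))
  where
  open ≤-Reasoning
  N = proj₁ (archimedean (r - 1ℚ) (0<q-p (≰⇒> r≰1)))
  recipN<r-1 = proj₂ (archimedean (r - 1ℚ) (0<q-p (≰⇒> r≰1)))
  n = suc N ℕ.* suc E
  x = fromℕ n
  0<x : 0ℚ < x
  0<x = subst (_< x) fromℕ-0 (fromℕ-mono-< {0} {n} (s≤s z≤n))
  E+1≡x*recipN : fromℕ (suc E) ≡ x * recip N
  E+1≡x*recipN = begin-equality
    fromℕ (suc E)                           ≡⟨ sym (*-identityˡ _) ⟩
    1ℚ * fromℕ (suc E)                      ≡⟨ cong (_* fromℕ (suc E)) (sym (fromℕ-suc*recip N)) ⟩
    fromℕ (suc N) * recip N * fromℕ (suc E)   ≡⟨ solve 3 (λ a b c → a :* b :* c := (a :* c) :* b) refl (fromℕ (suc N)) (recip N) (fromℕ (suc E)) ⟩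
    fromℕ (suc N) * fromℕ (suc E) * recip N   ≡⟨ cong (_* recip N) (sym (fromℕ-* (suc N) (suc E))) ⟩
    x * recip N                               ∎

HasDensityᵇ⇒HasDensity : ∀ {P : ℕ → Set} (P? : Decidable (λ n → P (suc n))) {S r} →
                         (∀ n → does (P? n) ≡ S (suc n)) → HasDensityᵇ S r → HasDensity P P? (const r)
HasDensityᵇ⇒HasDensity {P} P? {S} {r} P?≡S (density E bound) k = E ℕ.* suc k , close
  where
  count≡card : ∀ n → count P P? n ≡ card S n
  count≡card zero    = refl
  count≡card (suc n) = cong₂ ℕ._+_ (trans (if-⟦⟧ (does (P? n))) (cong ⟦_⟧ (P?≡S n))) (count≡card n)
    where
    if-⟦⟧ : ∀ b → (if b then 1 else 0) ≡ ⟦ b ⟧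
    if-⟦⟧ true  = refl
    if-⟦⟧ false = refl
  close : ∀ n → E ℕ.* suc k ℕ.≤ n → ∀ m → ∣ ratio P P? n - r ∣ ≤ inv k + inv m
  close n N≤n m = begin
    ∣ ratio P P? n - r ∣        ≡⟨ cong ∣_∣ ratio-r ⟩
    ∣ D * recip n ∣               ≡⟨ ∣p*q∣≡∣p∣*∣q∣ D (recip n) ⟩
    ∣ D ∣ * ∣ recip n ∣           ≡⟨ cong (∣ D ∣ *_) (0≤p⇒∣p∣≡p (0≤recip n)) ⟩
    ∣ D ∣ * recip n               ≤⟨ *-monoʳ-≤-nonNeg (recip n) {{nonNegative (0≤recip n)}} (bound (suc n)) ⟩
    fromℕ E * recip n             ≡⟨ sym (/-as-* E n) ⟩
    + E / suc n                 ≤⟨ cross-≤ (+ E) n (+ 1) k (subst₂ ℤ._≤_ (ℤP.pos-* E (suc k)) (ℤP.pos-* 1 (suc n))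
                                     (ℤ.+≤+ (subst (E ℕ.* suc k ℕ.≤_) (sym (ℕP.*-identityˡ (suc n))) (ℕP.m≤n⇒m≤1+n N≤n)))) ⟩
    + 1 / suc k                 ≡⟨ trans (sym (recip-lit k)) (recip≡inv k) ⟩
    inv k                       ≡⟨ sym (+-identityʳ (inv k)) ⟩
    inv k + 0ℚ                  ≤⟨ +-monoʳ-≤ (inv k) (subst (0ℚ ≤_) (recip≡inv m) (0≤recip m)) ⟩
    inv k + inv m               ∎
    where
    open ≤-Reasoning
    c = card S (suc n)
    D = fromℕ c - r * fromℕ (suc n)
    ratio-r : ratio P P? n - r ≡ D * recip n
    ratio-r = begin-equality
      ratio P P? n - r                             ≡⟨ cong (λ k → + k / suc n - r) (count≡card (suc n)) ⟩
      + c / suc n - r                              ≡⟨ cong (_- r) (/-as-* c n) ⟩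
      fromℕ c * recip n - r                          ≡⟨ cong (λ q → fromℕ c * recip n - q) (sym (trans (cong (r *_) (fromℕ-suc*recip n)) (*-identityʳ r))) ⟩
      fromℕ c * recip n - r * (fromℕ (suc n) * recip n) ≡⟨ solve 4 (λ a h r b → a :* h :- r :* (b :* h) := (a :- r :* b) :* h) refl (fromℕ c) (recip n) r (fromℕ (suc n)) ⟩
      D * recip n                                    ∎

opaque
  _∣ᵇ_ : ℕ → ℕ → Bool
  d ∣ᵇ n = does (d ∣? n)

  ∣⇒∣ᵇ : ∀ {d n} → d ∣ n → d ∣ᵇ n ≡ true
  ∣⇒∣ᵇ {d} {n} = dec-true (d ∣? n)

  ∤⇒∣ᵇ : ∀ {d n} → ¬ d ∣ n → d ∣ᵇ n ≡ false
  ∤⇒∣ᵇ {d} {n} = dec-false (d ∣? n)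

  ∣ᵇ⇒∣ : ∀ {d n} → d ∣ᵇ n ≡ true → d ∣ n
  ∣ᵇ⇒∣ {d} {n} h with d ∣? n
  ... | yes d∣n = d∣n

-- A positive integer is often indexed by its predecessor: recip s = 1/(s+1), and
-- dilate s X = (s + 1) · X = { (s + 1) x : x ∈ X }.
dilate : ℕ → (ℕ → Bool) → ℕ → Bool
dilate s X n = (suc s ∣ᵇ n) ∧ X (n ℕ./ suc s)

dilate⇒ : ∀ s X n → dilate s X n ≡ true → suc s ∣ n × X (n ℕ./ suc s) ≡ true
dilate⇒ s X n h with suc s ∣ᵇ n in eq
... | true = ∣ᵇ⇒∣ eq , h

⇒dilate : ∀ s X n → suc s ∣ n → X (n ℕ./ suc s) ≡ true → dilate s X n ≡ true
⇒dilate s X n s+1∣n x = cong₂ _∧_ (∣⇒∣ᵇ s+1∣n) x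

card-dilate-block : ∀ s X q t → t ℕ.≤ s → card (dilate s X) (q ℕ.* suc s ℕ.+ t) ≡ card (dilate s X) (q ℕ.* suc s)
card-dilate-block s X q zero    _   = cong (card (dilate s X)) (ℕP.+-identityʳ (q ℕ.* suc s))
card-dilate-block s X q (suc t) t<s = begin
  card (dilate s X) (q ℕ.* suc s ℕ.+ suc t)                                   ≡⟨ cong (card (dilate s X)) (ℕP.+-suc _ t) ⟩
  ⟦ dilate s X (suc (q ℕ.* suc s ℕ.+ t)) ⟧ ℕ.+ card (dilate s X) (q ℕ.* suc s ℕ.+ t) ≡⟨ cong (λ b → ⟦ b ∧ X (suc (q ℕ.* suc s ℕ.+ t) ℕ./ suc s) ⟧ ℕ.+ card (dilate s X) (q ℕ.* suc s ℕ.+ t)) (∤⇒∣ᵇ s+1∤) ⟩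
  card (dilate s X) (q ℕ.* suc s ℕ.+ t)                                       ≡⟨ card-dilate-block s X q t (ℕP.<⇒≤ t<s) ⟩
  card (dilate s X) (q ℕ.* suc s)                                             ∎
  where
  open ≡-Reasoning
  s+1∤ : ¬ suc s ∣ suc (q ℕ.* suc s ℕ.+ t)
  s+1∤ d = ℕP.<⇒≱ (s≤s t<s) (∣⇒≤ (∣m+n∣m⇒∣n (subst (suc s ∣_) (sym (ℕP.+-suc (q ℕ.* suc s) t)) d) (n∣m*n q)))

card-dilate-multiple : ∀ s X q → card (dilate s X) (q ℕ.* suc s) ≡ card X q
card-dilate-multiple s X zero    = refl
card-dilate-multiple s X (suc q) = begin
  card (dilate s X) (suc q ℕ.* suc s)                                      ≡⟨ cong (card (dilate s X)) e ⟩
  ⟦ dilate s X (suc (q ℕ.* suc s ℕ.+ s)) ⟧ ℕ.+ card (dilate s X) (q ℕ.* suc s ℕ.+ s) ≡⟨ cong₂ ℕ._+_ (cong ⟦_⟧ top) (card-dilate-block s X q s ℕP.≤-refl) ⟩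
  ⟦ X (suc q) ⟧ ℕ.+ card (dilate s X) (q ℕ.* suc s)                        ≡⟨ cong (⟦ X (suc q) ⟧ ℕ.+_) (card-dilate-multiple s X q) ⟩
  card X (suc q)                                                           ∎
  where
  open ≡-Reasoning
  e : suc q ℕ.* suc s ≡ suc (q ℕ.* suc s ℕ.+ s)
  e = cong suc (ℕP.+-comm s (q ℕ.* suc s))
  top : dilate s X (suc (q ℕ.* suc s ℕ.+ s)) ≡ X (suc q)
  top rewrite sym e = cong₂ _∧_ (∣⇒∣ᵇ {suc s} (n∣m*n (suc q))) (cong X (ℕ.m*n/n≡m (suc q) (suc s)))

card-dilate : ∀ s X n → card (dilate s X) n ≡ card X (n ℕ./ suc s)
card-dilate s X n = begin
  card (dilate s X) n                          ≡⟨ cong (card (dilate s X)) n≡q*[s+1]+t ⟩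
  card (dilate s X) (q ℕ.* suc s ℕ.+ t)        ≡⟨ card-dilate-block s X q t (ℕP.≤-pred (ℕ.m%n<n n (suc s))) ⟩
  card (dilate s X) (q ℕ.* suc s)              ≡⟨ card-dilate-multiple s X q ⟩
  card X q                                     ∎
  where
  open ≡-Reasoning
  q = n ℕ./ suc s
  t = n ℕ.% suc s
  n≡q*[s+1]+t : n ≡ q ℕ.* suc s ℕ.+ t
  n≡q*[s+1]+t = trans (ℕ.m≡m%n+[m/n]*n n (suc s)) (ℕP.+-comm t (q ℕ.* suc s))

∣p*recip*t∣≤∣↥p∣ : ∀ p {s t} → t ℕ.≤ s → ∣ p * (recip s * fromℕ t) ∣ ≤ fromℕ ℤ.∣ ↥ p ∣
∣p*recip*t∣≤∣↥p∣ p {s} {t} t≤s = begin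
  ∣ p * (recip s * fromℕ t) ∣   ≡⟨ ∣p*q∣≡∣p∣*∣q∣ p (recip s * fromℕ t) ⟩
  ∣ p ∣ * ∣ recip s * fromℕ t ∣ ≡⟨ cong (λ z → ∣ p ∣ * ∣ z ∣) (trans (*-comm (recip s) (fromℕ t)) (sym (/-as-* t s))) ⟩
  ∣ p ∣ * ∣ + t / suc s ∣       ≡⟨ cong (∣ p ∣ *_) (0≤p⇒∣p∣≡p (nonNegative⁻¹ (+ t / suc s) {{normalize-nonNeg t (suc s)}})) ⟩
  ∣ p ∣ * (+ t / suc s)         ≤⟨ *-monoˡ-≤-nonNeg ∣ p ∣ {{∣-∣-nonNeg p}} t/[s+1]≤1 ⟩
  ∣ p ∣ * 1ℚ                    ≡⟨ *-identityʳ ∣ p ∣ ⟩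
  ∣ p ∣                         ≤⟨ ∣p∣≤fromℕ∣↥p∣ p ⟩
  fromℕ ℤ.∣ ↥ p ∣               ∎
  where
  open ≤-Reasoning
  t/[s+1]≤1 : + t / suc s ≤ 1ℚ
  t/[s+1]≤1 = cross-≤ (+ t) s (+ 1) 0 (subst₂ ℤ._≤_ (ℤP.pos-* t 1) (ℤP.pos-* 1 (suc s))
    (ℤ.+≤+ (subst₂ ℕ._≤_ (sym (ℕP.*-identityʳ t)) (sym (ℕP.*-identityˡ (suc s))) (ℕP.m≤n⇒m≤1+n t≤s))))

dilate-density : ∀ s {X r} → HasDensityᵇ X r → HasDensityᵇ (dilate s X) (r * recip s)
dilate-density s {X} {r} (density E bound) = density (E ℕ.+ ℤ.∣ ↥ r ∣) bound′
  where
  bound′ : ∀ n → ∣ fromℕ (card (dilate s X) n) - (r * recip s) * fromℕ n ∣ ≤ fromℕ (E ℕ.+ ℤ.∣ ↥ r ∣)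
  bound′ n = begin
    ∣ fromℕ (card (dilate s X) n) - (r * h) * fromℕ n ∣   ≡⟨ cong ∣_∣ split ⟩
    ∣ (fromℕ c - r * fromℕ q) - r * (h * fromℕ t) ∣     ≤⟨ ∣p-q∣≤∣p∣+∣q∣ (fromℕ c - r * fromℕ q) (r * (h * fromℕ t)) ⟩
    ∣ fromℕ c - r * fromℕ q ∣ + ∣ r * (h * fromℕ t) ∣   ≤⟨ +-mono-≤ (bound q) (∣p*recip*t∣≤∣↥p∣ r (ℕP.≤-pred (ℕ.m%n<n n (suc s)))) ⟩
    fromℕ E + fromℕ ℤ.∣ ↥ r ∣                          ≡⟨ sym (fromℕ-+ E ℤ.∣ ↥ r ∣) ⟩
    fromℕ (E ℕ.+ ℤ.∣ ↥ r ∣)                            ∎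
    where
    open ≤-Reasoning
    h = recip s
    q = n ℕ./ suc s
    t = n ℕ.% suc s
    c = card X q
    n≡ : fromℕ n ≡ fromℕ q * fromℕ (suc s) + fromℕ t
    n≡ = trans (cong fromℕ (trans (ℕ.m≡m%n+[m/n]*n n (suc s)) (ℕP.+-comm t (q ℕ.* suc s))))
               (trans (fromℕ-+ (q ℕ.* suc s) t) (cong (_+ fromℕ t) (fromℕ-* q (suc s))))
    split : fromℕ (card (dilate s X) n) - (r * h) * fromℕ n ≡ (fromℕ c - r * fromℕ q) - r * (h * fromℕ t)
    split = begin-equality
      fromℕ (card (dilate s X) n) - (r * h) * fromℕ n                      ≡⟨ cong₂ (λ k z → fromℕ k - (r * h) * z) (card-dilate s X n) n≡ ⟩
      fromℕ c - (r * h) * (fromℕ q * fromℕ (suc s) + fromℕ t)              ≡⟨ solve 6 (λ c r h a b d → c :- (r :* h) :* (a :* b :+ d) := (c :- r :* a :* (b :* h)) :- r :* (h :* d)) refl (fromℕ c) r h (fromℕ q) (fromℕ (suc s)) (fromℕ t) ⟩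
      (fromℕ c - r * fromℕ q * (fromℕ (suc s) * h)) - r * (h * fromℕ t)  ≡⟨ cong (λ z → (fromℕ c - r * fromℕ q * z) - r * (h * fromℕ t)) (fromℕ-suc*recip s) ⟩
      (fromℕ c - r * fromℕ q * 1ℚ) - r * (h * fromℕ t)                    ≡⟨ cong (λ z → (fromℕ c - z) - r * (h * fromℕ t)) (*-identityʳ (r * fromℕ q)) ⟩
      (fromℕ c - r * fromℕ q) - r * (h * fromℕ t)                         ∎

record SquareDensities (a b : ℚ) : Set where
  field
    A A² : ℕ → Bool
    A-density : HasDensityᵇ A a
    A²-density : HasDensityᵇ A² b
    A²-spec : ∀ n → does (InSq? A n) ≡ A² (suc n)

does-≡ : ∀ {P : Set} (P? : Dec P) {b} → (b ≡ true → P) → (P → b ≡ true) → does P? ≡ b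
does-≡ (yes p) {b}     _ from = sym (from p)
does-≡ (no ¬p) {true}  to _   = ⊥-elim (¬p (to refl))
does-≡ (no ¬p) {false} _  _   = refl

T⇒≡true : ∀ {b} → T b → b ≡ true
T⇒≡true {true} _ = refl

≡true⇒T : ∀ {b} → b ≡ true → T b
≡true⇒T refl = _

multiples : ℕ → ℕ → Bool
multiples s n = suc s ∣ᵇ n

multiples-density : ∀ s → HasDensityᵇ (multiples s) (recip s)
multiples-density s = subst (HasDensityᵇ (multiples s)) (*-identityˡ (recip s))
  (HasDensityᵇ-cong (λ n → 𝔹.∧-identityʳ (multiples s (suc n))) (dilate-density s univ-density))

-- suc (mulIndex s s) = (s + 1)²
multiples-square : ∀ s n → does (InSq? (multiples s) n) ≡ multiples (mulIndex s s) (suc n)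
multiples-square s n = does-≡ (InSq? (multiples s) n) factor multiple
  where
  factor : multiples (mulIndex s s) (suc n) ≡ true → InSq (multiples s) (suc n)
  factor h = suc s , suc n ℕ./ suc s , ≡true⇒T (∣⇒∣ᵇ {suc s} ∣-refl) ,
             ≡true⇒T (∣⇒∣ᵇ (m*n∣o⇒n∣o/m (suc s) (suc s) (∣ᵇ⇒∣ h))) , ℕ.m*[n/m]≡n (m*n∣⇒m∣ (suc s) (suc s) (∣ᵇ⇒∣ h))
  multiple : InSq (multiples s) (suc n) → multiples (mulIndex s s) (suc n) ≡ true
  multiple (a , b , a∈ , b∈ , ab≡) =
    ∣⇒∣ᵇ (subst (suc s ℕ.* suc s ∣_) ab≡ (*-pres-∣ (∣ᵇ⇒∣ (T⇒≡true a∈)) (∣ᵇ⇒∣ (T⇒≡true b∈))))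

multiples-squareDensities : ∀ s → SquareDensities (recip s) (recip (mulIndex s s))
multiples-squareDensities s = record
  { A-density = multiples-density s
  ; A²-density = multiples-density (mulIndex s s)
  ; A²-spec = multiples-square s
  }

-- Rough numbers

hasSmallDivisor : ℕ → ℕ → Bool
hasSmallDivisor zero          n = false
hasSmallDivisor (suc zero)    n = false
hasSmallDivisor (suc (suc k)) n = (suc (suc k) ∣ᵇ n) ∨ hasSmallDivisor (suc k) n

rough : ℕ → ℕ → Bool
rough k n = not (hasSmallDivisor k n)

isPrime : ℕ → Bool
isPrime zero          = false
isPrime (suc zero)    = false
isPrime (suc (suc k)) = rough (suc k) (suc (suc k))

⇒hasSmallDivisor : ∀ k {d n} → 2 ℕ.≤ d → d ℕ.≤ k → d ∣ n → hasSmallDivisor k n ≡ true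
⇒hasSmallDivisor zero          2≤d d≤k _ = ⊥-elim (ℕP.<⇒≱ (ℕP.≤-trans 2≤d d≤k) z≤n)
⇒hasSmallDivisor (suc zero)    2≤d d≤k _ = ⊥-elim (ℕP.<⇒≱ (ℕP.≤-trans 2≤d d≤k) (s≤s z≤n))
-- The recursive call is made in the clause itself: routed through a with- or where-function,
-- the decrease from suc (suc k) to suc k is invisible to the termination checker.
⇒hasSmallDivisor (suc (suc k)) {d} {n} 2≤d d≤k d∣n = step (d ℕP.≟ suc (suc k)) (⇒hasSmallDivisor (suc k) 2≤d)
  where
  step : Dec (d ≡ suc (suc k)) → (d ℕ.≤ suc k → d ∣ n → hasSmallDivisor (suc k) n ≡ true) →
       hasSmallDivisor (suc (suc k)) n ≡ true
  step (yes refl) _     = cong (_∨ hasSmallDivisor (suc k) n) (∣⇒∣ᵇ d∣n)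
  step (no d≢)    below = trans (cong ((suc (suc k) ∣ᵇ n) ∨_) (below (ℕP.≤-pred (ℕP.≤∧≢⇒< d≤k d≢)) d∣n))
                              (𝔹.∨-zeroʳ (suc (suc k) ∣ᵇ n))

hasSmallDivisor⇒ : ∀ k n → hasSmallDivisor k n ≡ true → Σ ℕ λ d → 2 ℕ.≤ d × d ℕ.≤ k × d ∣ n
hasSmallDivisor⇒ (suc (suc k)) n h = step (suc (suc k) ∣ᵇ n) refl h (hasSmallDivisor⇒ (suc k) n)
  where
  step : ∀ b → suc (suc k) ∣ᵇ n ≡ b → b ∨ hasSmallDivisor (suc k) n ≡ true →
       (hasSmallDivisor (suc k) n ≡ true → Σ ℕ λ d → 2 ℕ.≤ d × d ℕ.≤ suc k × d ∣ n) →
       Σ ℕ λ d → 2 ℕ.≤ d × d ℕ.≤ suc (suc k) × d ∣ n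
  step true  eq _ _     = suc (suc k) , s≤s (s≤s z≤n) , ℕP.≤-refl , ∣ᵇ⇒∣ eq
  step false _  h below with below h
  ... | d , 2≤d , d≤k , d∣n = d , 2≤d , ℕP.m≤n⇒m≤1+n d≤k , d∣n

hasSmallDivisor-∣ : ∀ k {m n} → hasSmallDivisor k m ≡ true → m ∣ n → hasSmallDivisor k n ≡ true
hasSmallDivisor-∣ k {m} m-small m∣n with hasSmallDivisor⇒ k m m-small
... | d , 2≤d , d≤k , d∣m = ⇒hasSmallDivisor k 2≤d d≤k (∣-trans d∣m m∣n)

rough-coprime : ∀ k {d c} → 1 ℕ.≤ d → d ℕ.≤ k → rough k c ≡ true → Coprime d c
rough-coprime k {d} {c} 1≤d d≤k c-rough {i} (i∣d , i∣c) with i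
... | zero         = ⊥-elim (ℕP.<⇒≢ 1≤d (sym (0∣⇒≡0 i∣d)))
... | suc zero     = refl
... | suc (suc i′) = ⊥-elim (contradictionᵇ (⇒hasSmallDivisor k (s≤s (s≤s z≤n)) (ℕP.≤-trans (∣⇒≤ {{ℕ.>-nonZero 1≤d}} i∣d) d≤k) i∣c) c-rough)

rough-divisor : ∀ k {d c q} → 1 ℕ.≤ d → d ℕ.≤ k → rough k c ≡ true → d ∣ c ℕ.* q → d ∣ q
rough-divisor k 1≤d d≤k c-rough = coprime-divisor (rough-coprime k 1≤d d≤k c-rough)

prime-divisor : ∀ {d n} → 2 ℕ.≤ d → d ∣ n → Σ ℕ λ p → isPrime p ≡ true × p ℕ.≤ d × p ∣ n
prime-divisor {d} {n} = <-rec P step d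
  where
  P : ℕ → Set
  P d = 2 ℕ.≤ d → d ∣ n → Σ ℕ λ p → isPrime p ≡ true × p ℕ.≤ d × p ∣ n
  step : ∀ d → (∀ {d′} → d′ ℕ.< d → P d′) → P d
  step (suc (suc i)) below 2≤d d∣n with hasSmallDivisor (suc i) (suc (suc i)) in eq
  ... | false = suc (suc i) , cong not eq , ℕP.≤-refl , d∣n
  ... | true with hasSmallDivisor⇒ (suc i) (suc (suc i)) eq
  ...   | d′ , 2≤d′ , d′≤ , d′∣d with below (s≤s d′≤) 2≤d′ (∣-trans d′∣d d∣n)
  ...     | p , p-prime , p≤d′ , p∣n = p , p-prime , ℕP.≤-trans p≤d′ (ℕP.m≤n⇒m≤1+n d′≤) , p∣n
  step (suc zero) _ (s≤s ()) _

prime-divisor-≡ : ∀ {d p} → 2 ℕ.≤ d → d ∣ p → isPrime p ≡ true → d ≡ p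
prime-divisor-≡ {d} {suc (suc i)} 2≤d d∣p p-prime with d ℕP.≟ suc (suc i)
... | yes d≡p = d≡p
... | no  d≢p = ⊥-elim (contradictionᵇ (⇒hasSmallDivisor (suc i) 2≤d (ℕP.≤-pred (ℕP.≤∧≢⇒< (∣⇒≤ d∣p) d≢p)) d∣p) p-prime)

composite-step : ∀ k n → isPrime (suc k) ≡ false → hasSmallDivisor (suc k) n ≡ hasSmallDivisor k n
composite-step zero    n _ = refl
composite-step (suc i) n composite with suc (suc i) ∣ᵇ n in p∣ᵇn
... | false = refl
... | true with hasSmallDivisor⇒ (suc i) (suc (suc i)) (𝔹.not-injective composite)
...   | d , 2≤d , d≤k , d∣p = sym (⇒hasSmallDivisor (suc i) 2≤d d≤k (∣-trans d∣p (∣ᵇ⇒∣ p∣ᵇn)))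

prime-step : ∀ i n → isPrime (suc (suc i)) ≡ true →
             rough (suc i) n ∧ multiples (suc i) n ≡ dilate (suc i) (rough (suc i)) n
prime-step i n p-prime with suc (suc i) ∣ᵇ n in p∣ᵇn
... | false = 𝔹.∧-zeroʳ (rough (suc i) n)
... | true  = trans (𝔹.∧-identityʳ (rough (suc i) n)) (cong not (hasSmallDivisor-cofactor _ _ refl refl))
  where
  p = suc (suc i)
  q = n ℕ./ p
  pq≡n : p ℕ.* q ≡ n
  pq≡n = ℕ.m*[n/m]≡n (∣ᵇ⇒∣ p∣ᵇn)
  hasSmallDivisor-cofactor : ∀ a b → hasSmallDivisor (suc i) n ≡ a → hasSmallDivisor (suc i) q ≡ b → a ≡ b
  hasSmallDivisor-cofactor true false a b with hasSmallDivisor⇒ (suc i) n a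
  ... | d , 2≤d , d≤k , d∣n = trans (sym (⇒hasSmallDivisor (suc i) 2≤d d≤k
        (rough-divisor (suc i) (ℕP.≤-trans (s≤s z≤n) 2≤d) d≤k p-prime (subst (d ∣_) (sym pq≡n) d∣n)))) b
  hasSmallDivisor-cofactor false true a b with hasSmallDivisor⇒ (suc i) q b
  ... | d , 2≤d , d≤k , d∣q = trans (sym a) (⇒hasSmallDivisor (suc i) 2≤d d≤k (subst (d ∣_) pq≡n (∣n⇒∣m*n p d∣q)))
  hasSmallDivisor-cofactor true  true  _ _ = refl
  hasSmallDivisor-cofactor false false _ _ = refl

-- ∏_{p ≤ k} (1 - 1/p)
roughDensity : ℕ → ℚ
roughDensity zero    = 1ℚ
roughDensity (suc k) = if isPrime (suc k) then roughDensity k - roughDensity k * recip k else roughDensity k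

rough-density-step : ∀ i → HasDensityᵇ (rough (suc i)) (roughDensity (suc i)) →
                     HasDensityᵇ (rough (suc (suc i))) (roughDensity (suc (suc i)))
rough-density-step i dens with isPrime (suc (suc i)) in p-prime
... | false = HasDensityᵇ-cong (λ n → cong not (sym (composite-step (suc i) (suc n) p-prime))) dens
... | true  = HasDensityᵇ-cong (λ n → not-∨ (suc (suc i) ∣ᵇ suc n) (hasSmallDivisor (suc i) (suc n)))
  (∖-density {rough (suc i)} {multiples (suc i)} dens
    (HasDensityᵇ-cong (λ n → sym (prime-step i (suc n) p-prime)) (dilate-density (suc i) dens)))
  where
  not-∨ : ∀ a b → not b ∧ not a ≡ not (a ∨ b)
  not-∨ true  b = 𝔹.∧-zeroʳ (not b)
  not-∨ false b = 𝔹.∧-identityʳ (not b)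

rough-density : ∀ k → HasDensityᵇ (rough k) (roughDensity k)
rough-density zero          = univ-density
rough-density (suc zero)    = univ-density
rough-density (suc (suc i)) = rough-density-step i (rough-density (suc i))

harmonicOn : (ℕ → Bool) → ℕ → ℚ
harmonicOn sel zero    = 0ℚ
harmonicOn sel (suc j) = if sel j then harmonicOn sel j + recip j else harmonicOn sel j

roughMultiples : (ℕ → Bool) → ℕ → ℕ → ℕ → Bool
roughMultiples sel k zero    n = false
roughMultiples sel k (suc j) n = (sel j ∧ dilate j (rough k) n) ∨ roughMultiples sel k j n

roughMultiples⇒ : ∀ sel k j n → roughMultiples sel k j n ≡ true →
                  Σ ℕ λ s → s ℕ.< j × sel s ≡ true × dilate s (rough k) n ≡ true
roughMultiples⇒ sel k (suc j) n h with ∨≡true⇒ (sel j ∧ dilate j (rough k) n) h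
... | inj₁ here  = j , ℕP.≤-refl , 𝔹.∧-conicalˡ (sel j) _ here , 𝔹.∧-conicalʳ (sel j) _ here
... | inj₂ there with roughMultiples⇒ sel k j n there
...   | s , s<j , sel-s , n∈ = s , ℕP.m≤n⇒m≤1+n s<j , sel-s , n∈

⇒roughMultiples : ∀ sel k j n {s} → s ℕ.< j → sel s ≡ true → dilate s (rough k) n ≡ true → roughMultiples sel k j n ≡ true
⇒roughMultiples sel k (suc j) n {s} s<j sel-s n∈ with s ℕP.≟ j
... | yes refl rewrite sel-s | n∈ = refl
... | no  s≢j  = trans (cong ((sel j ∧ dilate j (rough k) n) ∨_) (⇒roughMultiples sel k j n (ℕP.≤∧≢⇒< (ℕP.≤-pred s<j) s≢j) sel-s n∈))
                       (𝔹.∨-zeroʳ _)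

rough-dilate-unique : ∀ k {s t n} → suc s ℕ.≤ k → suc t ℕ.≤ k →
                      dilate s (rough k) n ≡ true → dilate t (rough k) n ≡ true → s ≡ t
rough-dilate-unique k {s} {t} {n} s<k t<k n∈s n∈t with dilate⇒ s (rough k) n n∈s | dilate⇒ t (rough k) n n∈t
... | s+1∣n , c-rough | t+1∣n , c′-rough = ℕP.suc-injective (∣-antisym (divides s+1∣n t+1∣n c′-rough s<k) (divides t+1∣n s+1∣n c-rough t<k))
  where
  divides : ∀ {a b} → suc a ∣ n → suc b ∣ n → rough k (n ℕ./ suc b) ≡ true → suc a ℕ.≤ k → suc a ∣ suc b
  divides {a} {b} a+1∣n b+1∣n cofactor-rough a<k =
    rough-divisor k (s≤s z≤n) a<k cofactor-rough (subst (suc a ∣_) (sym (ℕ.m/n*n≡m b+1∣n)) a+1∣n)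

roughMultiples-density : ∀ sel k j → j ℕ.≤ k → HasDensityᵇ (roughMultiples sel k j) (roughDensity k * harmonicOn sel j)
roughMultiples-density sel k zero    _   = subst (HasDensityᵇ (λ _ → false)) (sym (*-zeroʳ (roughDensity k))) empty-density
roughMultiples-density sel k (suc j) j<k = step (sel j) refl (roughMultiples-density sel k j (ℕP.<⇒≤ j<k))
  where
  ρ = roughDensity k
  U = roughMultiples sel k j
  step : ∀ b → sel j ≡ b → HasDensityᵇ U (ρ * harmonicOn sel j) → HasDensityᵇ (roughMultiples sel k (suc j)) (ρ * harmonicOn sel (suc j))
  step false sel-j dens rewrite sel-j = dens
  step true  sel-j dens rewrite sel-j = subst (HasDensityᵇ (dilate j (rough k) ∪ U)) (trans (+-comm (ρ * recip j) (ρ * harmonicOn sel j)) (sym (*-distribˡ-+ ρ (harmonicOn sel j) (recip j))))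
    (∪-density {dilate j (rough k)} {U} disjoint (dilate-density j (rough-density k)) dens)
    where
    disjoint : ∀ n → dilate j (rough k) n ≡ true → U n ≡ false
    disjoint n n∈ with U n in n∈U
    ... | false = refl
    ... | true with roughMultiples⇒ sel k j n n∈U
    ...   | s , s<j , _ , n∈′ = ⊥-elim (ℕP.<⇒≢ s<j (rough-dilate-unique k (ℕP.<-trans s<j j<k) j<k n∈′ n∈))

isPrime⁺ : ℕ → Bool
isPrime⁺ s = isPrime (suc s)

-- Σ_{p ≤ k prime} 1/p
primeHarmonic : ℕ → ℚ
primeHarmonic = harmonicOn isPrime⁺

-- { p c : p ≤ k prime, c k-rough }
primeTimesRough : ℕ → ℕ → Bool
primeTimesRough k = roughMultiples isPrime⁺ k k

prime⇒2≤ : ∀ {p} → isPrime p ≡ true → 2 ℕ.≤ p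
prime⇒2≤ {suc (suc _)} _ = s≤s (s≤s z≤n)

primeTimesRough⊆hasSmallDivisor : ∀ k n → primeTimesRough k n ≡ true → hasSmallDivisor k n ≡ true
primeTimesRough⊆hasSmallDivisor k n h with roughMultiples⇒ isPrime⁺ k k n h
... | s , s<k , s+1-prime , n∈ = ⇒hasSmallDivisor k (prime⇒2≤ s+1-prime) s<k (proj₁ (dilate⇒ s (rough k) n n∈))

prime∣small-divisor : ∀ k {x c p} → hasSmallDivisor k x ≡ true → rough k c ≡ true → isPrime p ≡ true → x ∣ c ℕ.* p → p ∣ x
prime∣small-divisor k x-small c-rough p-prime x∣cp with hasSmallDivisor⇒ k _ x-small
... | d , 2≤d , d≤k , d∣x with prime-divisor-≡ 2≤d (rough-divisor k (ℕP.≤-trans (s≤s z≤n) 2≤d) d≤k c-rough (∣-trans d∣x x∣cp)) p-prime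
...   | refl = d∣x

product∉primeTimesRough : ∀ k {a b} → hasSmallDivisor k a ≡ true → hasSmallDivisor k b ≡ true →
                          primeTimesRough k (a ℕ.* b) ≡ false
product∉primeTimesRough k {a} {b} a-small b-small with primeTimesRough k (a ℕ.* b) in ab∈E
... | false = refl
... | true with roughMultiples⇒ isPrime⁺ k k (a ℕ.* b) ab∈E
...   | s , s<k , p-prime , ab∈pC with dilate⇒ s (rough k) (a ℕ.* b) ab∈pC
...     | p∣ab , c-rough = ⊥-elim (contradictionᵇ (⇒hasSmallDivisor k (prime⇒2≤ p-prime) s<k p∣c) c-rough)
  where
  p = suc s
  c = a ℕ.* b ℕ./ p
  cp≡ab : c ℕ.* p ≡ a ℕ.* b
  cp≡ab = ℕ.m/n*n≡m p∣ab
  p∣c : p ∣ c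
  p∣c = *-cancelˡ-∣ p (subst (p ℕ.* p ∣_) (trans (sym cp≡ab) (ℕP.*-comm c p))
    (*-pres-∣ (prime∣small-divisor k a-small c-rough p-prime (subst (a ∣_) (sym cp≡ab) (∣m⇒∣m*n b ∣-refl)))
              (prime∣small-divisor k b-small c-rough p-prime (subst (b ∣_) (sym cp≡ab) (∣n⇒∣m*n a ∣-refl)))))

hasSmallDivisor∖primeTimesRough⇒square : ∀ k n → (hasSmallDivisor k ∖ primeTimesRough k) n ≡ true → InSq (hasSmallDivisor k) n
hasSmallDivisor∖primeTimesRough⇒square k n h with hasSmallDivisor⇒ k n (𝔹.∧-conicalˡ (hasSmallDivisor k n) _ h)
... | d , 2≤d , d≤k , d∣n with prime-divisor 2≤d d∣n
...   | p@(suc (suc i)) , p-prime , p≤d , p∣n with hasSmallDivisor k (n ℕ./ p) in cofactor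
...     | true  = p , n ℕ./ p , ≡true⇒T (⇒hasSmallDivisor k (prime⇒2≤ p-prime) (ℕP.≤-trans p≤d d≤k) ∣-refl) ,
                  ≡true⇒T cofactor , ℕ.m*[n/m]≡n p∣n
...     | false = ⊥-elim (contradictionᵇ
                    (⇒roughMultiples isPrime⁺ k k n (ℕP.≤-trans p≤d d≤k) p-prime (⇒dilate (suc i) (rough k) n p∣n (cong not cofactor)))
                    (𝔹.∧-conicalʳ (hasSmallDivisor k n) _ h))

hasSmallDivisor-square : ∀ k n → does (InSq? (hasSmallDivisor k) n) ≡ (hasSmallDivisor k ∖ primeTimesRough k) (suc n)
hasSmallDivisor-square k n = does-≡ (InSq? (hasSmallDivisor k) n) (hasSmallDivisor∖primeTimesRough⇒square k (suc n)) square⇒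
  where
  square⇒ : InSq (hasSmallDivisor k) (suc n) → (hasSmallDivisor k ∖ primeTimesRough k) (suc n) ≡ true
  square⇒ (a , b , a∈ , b∈ , ab≡n) = subst (λ x → (hasSmallDivisor k ∖ primeTimesRough k) x ≡ true) ab≡n
    (cong₂ _∧_ (hasSmallDivisor-∣ k (T⇒≡true a∈) (∣m⇒∣m*n b ∣-refl))
               (cong not (product∉primeTimesRough k (T⇒≡true a∈) (T⇒≡true b∈))))

hasSmallDivisor-density : ∀ k → HasDensityᵇ (hasSmallDivisor k) (1ℚ - roughDensity k)
hasSmallDivisor-density k = HasDensityᵇ-cong (λ n → 𝔹.not-involutive (hasSmallDivisor k (suc n))) (complement-density (rough-density k))

hasSmallDivisor-squareDensities : ∀ k →
  SquareDensities (1ℚ - roughDensity k) ((1ℚ - roughDensity k) - roughDensity k * primeHarmonic k)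
hasSmallDivisor-squareDensities k = record
  { A-density = hasSmallDivisor-density k
  ; A²-density = ∖-density {hasSmallDivisor k} {primeTimesRough k} (hasSmallDivisor-density k)
      (HasDensityᵇ-cong (λ n → ∩-sub (primeTimesRough⊆hasSmallDivisor k (suc n))) (roughMultiples-density isPrime⁺ k k ℕP.≤-refl))
  ; A²-spec = hasSmallDivisor-square k
  }
  where
  ∩-sub : ∀ {a b} → (b ≡ true → a ≡ true) → b ≡ a ∧ b
  ∩-sub {true}  _ = refl
  ∩-sub {false} {true}  b⇒a = sym (b⇒a refl)
  ∩-sub {false} {false} _   = refl

-- Estimates for the density of rough numbers

if-elim : ∀ {A : Set} (P : A → Set) b {x y} → P x → P y → P (if b then x else y)
if-elim P true  px _  = px
if-elim P false _  py = py

0<roughDensity : ∀ k → 0ℚ < roughDensity k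
0<roughDensity zero          = positive⁻¹ 1ℚ
0<roughDensity (suc zero)    = positive⁻¹ 1ℚ
0<roughDensity (suc k@(suc j)) = step (0<roughDensity k)
  where
  step : 0ℚ < roughDensity k → 0ℚ < roughDensity (suc k)
  step 0<ρ = if-elim (0ℚ <_) (isPrime (suc k))
    (subst (0ℚ <_) (solve 2 (λ ρ r → ρ :* (con 1ℚ :- r) := ρ :- ρ :* r) refl (roughDensity k) (recip k))
       (0<p*q 0<ρ (0<q-p (subst (recip k <_) recip-0 (recip-antimono-< {0} {k} (s≤s z≤n))))))
    0<ρ

≤-by-steps : ∀ (f : ℕ → ℚ) → (∀ k → f k ≤ f (suc k)) → ∀ {k K} → k ℕ.≤ K → f k ≤ f K
≤-by-steps f step {k} {K} k≤K with ℕP.≤⇒≤′ k≤K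
... | ℕ.≤′-refl       = ≤-refl
... | ℕ.≤′-step k≤′K′ = ≤-trans (≤-by-steps f step (ℕP.≤′⇒≤ k≤′K′)) (step _)

≥-by-steps : ∀ (f : ℕ → ℚ) → (∀ k → f (suc k) ≤ f k) → ∀ {k K} → k ℕ.≤ K → f K ≤ f k
≥-by-steps f step {k} {K} k≤K with ℕP.≤⇒≤′ k≤K
... | ℕ.≤′-refl       = ≤-refl
... | ℕ.≤′-step k≤′K′ = ≤-trans (step _) (≥-by-steps f step (ℕP.≤′⇒≤ k≤′K′))

roughDensity-antitone : ∀ {k K} → k ℕ.≤ K → roughDensity K ≤ roughDensity k
roughDensity-antitone = ≥-by-steps roughDensity step
  where
  step : ∀ k → roughDensity (suc k) ≤ roughDensity k
  step k = if-elim (_≤ roughDensity k) (isPrime (suc k))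
    (0≤q-p⇒p≤q (subst (0ℚ ≤_) (solve 2 (λ ρ r → ρ :* r := ρ :- (ρ :- ρ :* r)) refl (roughDensity k) (recip k))
      (0≤p*q (<⇒≤ (0<roughDensity k)) (0≤recip k))))
    ≤-refl

-- Removing a prime p ≥ 3 loses at most a third of the rough numbers.
roughDensity-step : ∀ j → roughDensity (suc (suc j)) * fromℕ 2 ≤ roughDensity (suc (suc (suc j))) * fromℕ 3
roughDensity-step j = if-elim (λ x → ρ * fromℕ 2 ≤ x * fromℕ 3) (isPrime (suc k))
  (0≤q-p⇒p≤q (subst (0ℚ ≤_) gap (0≤p*q 0≤ρ (0≤p*q (0≤fromℕ 3) (0≤q-p (recip-antimono-≤ {2} {k} (s≤s (s≤s z≤n))))))))
  (*-monoˡ-≤-nonNeg ρ {{nonNegative 0≤ρ}} (fromℕ-mono-≤ {2} {3} (s≤s (s≤s z≤n))))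
  where
  k = suc (suc j)
  ρ = roughDensity k
  r = recip k
  0≤ρ = <⇒≤ (0<roughDensity k)
  t = fromℕ 2
  gap : ρ * (fromℕ 3 * (recip 2 - r)) ≡ (ρ - ρ * r) * fromℕ 3 - ρ * t
  gap = begin
    ρ * (fromℕ 3 * (recip 2 - r))            ≡⟨ solve 4 (λ ρ t x r → ρ :* (t :* (x :- r)) := ρ :* (t :* x) :- ρ :* t :* r) refl ρ (fromℕ 3) (recip 2) r ⟩
    ρ * (fromℕ 3 * recip 2) - ρ * fromℕ 3 * r ≡⟨ cong₂ (λ u v → ρ * u - ρ * v * r) (fromℕ-suc*recip 2) (fromℕ-suc 2) ⟩
    ρ * 1ℚ - ρ * (t + 1ℚ) * r                 ≡⟨ solve 3 (λ ρ t r → ρ :* con 1ℚ :- ρ :* (t :+ con 1ℚ) :* r := (ρ :- ρ :* r) :* (t :+ con 1ℚ) :- ρ :* t) refl ρ t r ⟩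
    (ρ - ρ * r) * (t + 1ℚ) - ρ * t            ≡⟨ cong (λ u → (ρ - ρ * r) * u - ρ * t) (sym (fromℕ-suc 2)) ⟩
    (ρ - ρ * r) * fromℕ 3 - ρ * t             ∎
    where open ≡-Reasoning

harmonicOn-monotone : ∀ sel {k K} → k ℕ.≤ K → harmonicOn sel k ≤ harmonicOn sel K
harmonicOn-monotone sel = ≤-by-steps (harmonicOn sel) step
  where
  step : ∀ k → harmonicOn sel k ≤ harmonicOn sel (suc k)
  step k = if-elim (harmonicOn sel k ≤_) (sel k)
    (subst (_≤ harmonicOn sel k + recip k) (+-identityʳ (harmonicOn sel k)) (+-monoʳ-≤ (harmonicOn sel k) (0≤recip k)))
    ≤-refl

5/6≤primeHarmonic : ∀ {k} → 3 ℕ.≤ k → + 5 / 6 ≤ primeHarmonic k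
5/6≤primeHarmonic 3≤k = ≤-trans (≤-reflexive (sym primeHarmonic-3)) (harmonicOn-monotone isPrime⁺ 3≤k)
  where
  isPrime-3 : isPrime 3 ≡ true
  isPrime-3 = cong (λ b → not (b ∨ false)) (∤⇒∣ᵇ (toWitnessFalse {a? = 2 ∣? 3} _))
  primeHarmonic-3 : primeHarmonic 3 ≡ + 5 / 6
  primeHarmonic-3 rewrite isPrime-3 | recip-lit 1 | recip-lit 2 = refl

harmonic : ℕ → ℚ
harmonic = harmonicOn (λ _ → true)

harmonic-block : ∀ m t → harmonic (suc m) + fromℕ t * recip (m ℕ.+ t) ≤ harmonic (suc m ℕ.+ t)
harmonic-block m zero = ≤-reflexive (begin-equality
  harmonic (suc m) + fromℕ 0 * recip (m ℕ.+ 0) ≡⟨ cong (λ z → harmonic (suc m) + z) (trans (cong (_* recip (m ℕ.+ 0)) fromℕ-0) (*-zeroˡ (recip (m ℕ.+ 0)))) ⟩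
  harmonic (suc m) + 0ℚ                     ≡⟨ +-identityʳ _ ⟩
  harmonic (suc m)                          ≡⟨ cong (λ z → harmonic (suc z)) (sym (ℕP.+-identityʳ m)) ⟩
  harmonic (suc m ℕ.+ 0)                    ∎)
  where open ≤-Reasoning
harmonic-block m (suc t) = subst (λ n → harmonic (suc m) + fromℕ (suc t) * recip n ≤ harmonic (suc n)) (sym (ℕP.+-suc m t)) (begin
  harmonic (suc m) + fromℕ (suc t) * recip (suc n)        ≡⟨ cong (λ z → harmonic (suc m) + z * recip (suc n)) (fromℕ-suc t) ⟩
  harmonic (suc m) + (fromℕ t + 1ℚ) * recip (suc n)       ≡⟨ solve 3 (λ h a r → h :+ (a :+ con 1ℚ) :* r := (h :+ a :* r) :+ r) refl (harmonic (suc m)) (fromℕ t) (recip (suc n)) ⟩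
  (harmonic (suc m) + fromℕ t * recip (suc n)) + recip (suc n) ≤⟨ +-monoˡ-≤ (recip (suc n)) (+-monoʳ-≤ (harmonic (suc m))
                                                            (*-monoˡ-≤-nonNeg (fromℕ t) {{nonNegative (0≤fromℕ t)}} (recip-antimono-≤ (ℕP.n≤1+n n)))) ⟩
  (harmonic (suc m) + fromℕ t * recip n) + recip (suc n)     ≤⟨ +-monoˡ-≤ (recip (suc n)) (harmonic-block m t) ⟩
  harmonic (suc n) + recip (suc n)                         ∎)
  where
  n = m ℕ.+ t
  open ≤-Reasoning

harmonic-double : ∀ m → harmonic (suc m) + ½ ≤ harmonic (suc m ℕ.+ suc m)
harmonic-double m = subst (λ x → harmonic (suc m) + x ≤ harmonic (suc m ℕ.+ suc m)) half (harmonic-block m (suc m))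
  where
  half : fromℕ (suc m) * recip (m ℕ.+ suc m) ≡ ½
  half = subst (λ n → fromℕ (suc m) * recip n ≡ ½)
    (trans (cong suc (trans (ℕP.*-comm m 2) (cong (m ℕ.+_) (ℕP.+-identityʳ m)))) (sym (ℕP.+-suc m m)))
    (trans (fromℕ-suc*recip-mulIndex m 1) recip-1)

harmonic-quadruple : ∀ n .{{_ : ℕ.NonZero n}} → harmonic n + 1ℚ ≤ harmonic (4 ℕ.* n)
harmonic-quadruple n@(suc m) = begin
  harmonic n + 1ℚ                  ≡⟨ solve 1 (λ h → h :+ con 1ℚ := (h :+ con ½) :+ con ½) refl (harmonic n) ⟩
  (harmonic n + ½) + ½             ≤⟨ +-monoˡ-≤ ½ (harmonic-double m) ⟩
  harmonic (n ℕ.+ n) + ½           ≤⟨ harmonic-double (m ℕ.+ n) ⟩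
  harmonic ((n ℕ.+ n) ℕ.+ (n ℕ.+ n)) ≡⟨ cong harmonic (sym (trans (ℕP.*-distribʳ-+ n 2 2) (cong₂ ℕ._+_ 2n≡n+n 2n≡n+n))) ⟩
  harmonic (4 ℕ.* n)               ∎
  where
  open ≤-Reasoning
  2n≡n+n : 2 ℕ.* n ≡ n ℕ.+ n
  2n≡n+n = cong (n ℕ.+_) (ℕP.+-identityʳ n)

harmonic-4^ : ∀ t → fromℕ t ≤ harmonic (4 ℕ.^ t)
harmonic-4^ zero    = subst₂ _≤_ (sym fromℕ-0) (cong (λ z → 0ℚ + z) (sym recip-0)) (toWitness {a? = 0ℚ ≤? 0ℚ + 1ℚ} _)
harmonic-4^ (suc t) = begin
  fromℕ (suc t)              ≡⟨ fromℕ-suc t ⟩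
  fromℕ t + 1ℚ               ≤⟨ +-monoˡ-≤ 1ℚ (harmonic-4^ t) ⟩
  harmonic (4 ℕ.^ t) + 1ℚ    ≤⟨ harmonic-quadruple (4 ℕ.^ t) {{ℕP.m^n≢0 4 t}} ⟩
  harmonic (4 ℕ.^ suc t)     ∎
  where open ≤-Reasoning

-- The multiples (s + 1) · rough k, s < k, are disjoint, so their total density ρ k · H k is at most 1.
roughDensity-vanishes : ∀ T → Σ ℕ λ K → roughDensity K * fromℕ T ≤ 1ℚ
roughDensity-vanishes T = K , (begin
  roughDensity K * fromℕ T      ≤⟨ *-monoˡ-≤-nonNeg (roughDensity K) {{nonNegative (<⇒≤ (0<roughDensity K))}} (harmonic-4^ T) ⟩
  roughDensity K * harmonic K   ≤⟨ density≤1 (roughMultiples-density (λ _ → true) K K ℕP.≤-refl) ⟩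
  1ℚ                            ∎)
  where
  K = 4 ℕ.^ T
  open ≤-Reasoning

-- Separating a rational from the densities of a set and of its square

Separation : ℚ → ℚ → Set
Separation y g = Σ ℚ λ a → Σ ℚ λ b → SquareDensities a b × y < a × b + g < y

ascending-crossing : ∀ (a b : ℕ → ℚ) {y g} J → a 0 ≤ y → y < a J →
                     (∀ j → j ℕ.< J → b (suc j) + g < a j) → Σ ℕ λ j → y < a j × b j + g < y
ascending-crossing a b zero    a₀≤y y<a₀ _   = ⊥-elim (<-irrefl refl (≤-<-trans a₀≤y y<a₀))
ascending-crossing a b {y} (suc J) a₀≤y y<aJ gap with y <? a J
... | yes y<a = ascending-crossing a b J a₀≤y y<a (λ j j<J → gap j (ℕP.m≤n⇒m≤1+n j<J))
... | no  y≮a = suc J , y<aJ , <-≤-trans (gap J ℕP.≤-refl) (≮⇒≥ y≮a)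

descending-crossing : ∀ (a b : ℕ → ℚ) {y g} J → y < a 0 → a J ≤ y →
                      (∀ j → j ℕ.< J → b j + g < a (suc j)) → Σ ℕ λ j → y < a j × b j + g < y
descending-crossing a b zero    y<a₀ a₀≤y _   = ⊥-elim (<-irrefl refl (≤-<-trans a₀≤y y<a₀))
descending-crossing a b {y} (suc J) y<a₀ aJ≤y gap with y <? a J
... | yes y<a = J , y<a , <-≤-trans (gap J ℕP.≤-refl) aJ≤y
... | no  y≮a = descending-crossing a b J y<a₀ (≮⇒≥ y≮a) (λ j j<J → gap j (ℕP.m≤n⇒m≤1+n j<J))

multiplesMargin : ℕ → ℕ
multiplesMargin s = mulIndex (suc s) (mulIndex s s)

multiples-gap : ∀ s → 1 ℕ.≤ s → recip (mulIndex s s) + recip (multiplesMargin s) ≤ recip (suc s)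
multiples-gap s 1≤s = begin
  recip S + recip X                      ≡⟨ cong (_+ recip X) (sym (fromℕ-suc*recip-mulIndex (suc s) S)) ⟩
  fromℕ (suc (suc s)) * recip X + recip X ≡⟨ solve 2 (λ a r → a :* r :+ r := (a :+ con 1ℚ) :* r) refl (fromℕ (suc (suc s))) (recip X) ⟩
  (fromℕ (suc (suc s)) + 1ℚ) * recip X  ≡⟨ cong (_* recip X) (sym (fromℕ-suc (suc (suc s)))) ⟩
  fromℕ (3 ℕ.+ s) * recip X            ≤⟨ *-monoʳ-≤-nonNeg (recip X) {{nonNegative (0≤recip X)}} (fromℕ-mono-≤ 3+s≤S+1) ⟩
  fromℕ (suc S) * recip X              ≡⟨ cong (λ n → fromℕ (suc S) * recip n) X≡ ⟩
  fromℕ (suc S) * recip (mulIndex S (suc s)) ≡⟨ fromℕ-suc*recip-mulIndex S (suc s) ⟩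
  recip (suc s)                        ∎
  where
  open ≤-Reasoning
  S = mulIndex s s
  X = multiplesMargin s
  X≡ : X ≡ mulIndex S (suc s)
  X≡ = ℕP.suc-injective (ℕP.*-comm (suc (suc s)) (suc S))
  3+s≤S+1 : 3 ℕ.+ s ℕ.≤ suc S
  3+s≤S+1 = s≤s (subst (2 ℕ.+ s ℕ.≤_) (ℕP.+-comm (s ℕ.* suc s) s) (ℕP.+-monoˡ-≤ s (ℕP.*-mono-≤ 1≤s (s≤s 1≤s))))

mulIndex-mono : ∀ {c c′ n n′} → c ℕ.≤ c′ → n ℕ.≤ n′ → mulIndex c n ℕ.≤ mulIndex c′ n′
mulIndex-mono c≤c′ n≤n′ = ℕP.+-mono-≤ n≤n′ (ℕP.*-mono-≤ c≤c′ (s≤s n≤n′))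

multiples-separation : ∀ lo {y g} → recip lo ≤ y → y < ½ → g < recip (multiplesMargin lo) → Separation y g
multiples-separation lo {y} {g} lo≤y y<½ g<margin =
  separate (descending-crossing a b lo (subst (y <_) (sym recip-1) y<½) (≤-trans (recip-antimono-≤ (ℕP.n≤1+n lo)) lo≤y) gaps)
  where
  a b : ℕ → ℚ
  a j = recip (suc j)
  b j = recip (mulIndex (suc j) (suc j))
  gaps : ∀ j → j ℕ.< lo → b j + g < a (suc j)
  gaps j j<lo = <-≤-trans (+-monoʳ-< (b j) (<-≤-trans g<margin margin≤)) (multiples-gap (suc j) (s≤s z≤n))
    where
    margin≤ : recip (multiplesMargin lo) ≤ recip (multiplesMargin (suc j))
    margin≤ = recip-antimono-≤ (mulIndex-mono (s≤s j<lo) (mulIndex-mono j<lo j<lo))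
  separate : Σ ℕ (λ j → y < a j × b j + g < y) → Separation y g
  separate (j , y<a , b+g<y) = a j , b j , multiples-squareDensities (suc j) , y<a , b+g<y

-- (1 - ρ) - ((1 - ρ′) - ρ′ σ + g) = ½ (3 ρ′ - 2 ρ) + ρ′ (σ - 5/6) + ⅓ (ρ′ - 3 g)
rough-gap : ∀ {ρ ρ′ σ g} → 0ℚ ≤ ρ′ → ρ * fromℕ 2 ≤ ρ′ * fromℕ 3 → + 5 / 6 ≤ σ → g * fromℕ 3 < ρ′ →
            (1ℚ - ρ′) - ρ′ * σ + g < 1ℚ - ρ
rough-gap {ρ} {ρ′} {σ} {g} 0≤ρ′ 2ρ≤3ρ′ 5/6≤σ 3g<ρ′ rewrite fromℕ-lit 2 | fromℕ-lit 3 = 0<q-p⇒p<q (begin-strict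
  0ℚ                                                        ≡⟨ sym (+-identityʳ 0ℚ) ⟩
  0ℚ + 0ℚ                                                   <⟨ +-mono-≤-< (0≤p+q (0≤p*q (0≤q-p 2ρ≤3ρ′) (nonNegative⁻¹ ½)) (0≤p*q 0≤ρ′ (0≤q-p 5/6≤σ)))
                                                                          (0<p*q (0<q-p 3g<ρ′) (positive⁻¹ (+ 1 / 3))) ⟩
  ((ρ′ * three - ρ * two) * ½ + ρ′ * (σ - + 5 / 6)) + (ρ′ - g * three) * (+ 1 / 3)
      ≡⟨ solve 4 (λ ρ ρ′ σ g → ((ρ′ :* con three :- ρ :* con two) :* con ½ :+ ρ′ :* (σ :- con (+ 5 / 6))) :+ (ρ′ :- g :* con three) :* con (+ 1 / 3)
                              := (con 1ℚ :- ρ) :- ((con 1ℚ :- ρ′) :- ρ′ :* σ :+ g)) refl ρ ρ′ σ g ⟩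
  (1ℚ - ρ) - ((1ℚ - ρ′) - ρ′ * σ + g)                      ∎)
  where
  open ≤-Reasoning
  two three : ℚ
  two = + 2 / 1
  three = + 3 / 1

rough-separation : ∀ K {y g} → ½ ≤ y → y < 1ℚ - roughDensity K → g * fromℕ 3 < roughDensity (2 ℕ.+ K) → Separation y g
rough-separation K {y} {g} ½≤y y<1-ρK 3g<ρ = separate (ascending-crossing a b K (subst (_≤ y) (sym a₀≡½) ½≤y) y<aK gaps)
  where
  ρ : ℕ → ℚ
  ρ j = roughDensity (2 ℕ.+ j)
  a b : ℕ → ℚ
  a j = 1ℚ - ρ j
  b j = (1ℚ - ρ j) - ρ j * primeHarmonic (2 ℕ.+ j)
  a₀≡½ : a 0 ≡ ½
  a₀≡½ rewrite recip-1 = refl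
  y<aK : y < a K
  y<aK = <-≤-trans y<1-ρK (+-monoʳ-≤ 1ℚ (neg-antimono-≤ (roughDensity-antitone (ℕP.m≤n+m K 2))))
  gaps : ∀ j → j ℕ.< K → b (suc j) + g < a j
  gaps j j<K = rough-gap {ρ j} {ρ (suc j)} {primeHarmonic (3 ℕ.+ j)} (<⇒≤ (0<roughDensity (3 ℕ.+ j))) (roughDensity-step j) (5/6≤primeHarmonic (s≤s (s≤s (s≤s z≤n))))
                         (<-≤-trans 3g<ρ (roughDensity-antitone (s≤s (s≤s j<K))))
  separate : Σ ℕ (λ j → y < a j × b j + g < y) → Separation y g
  separate (j , y<a , b+g<y) = a j , b j , hasSmallDivisor-squareDensities (2 ℕ.+ j) , y<a , b+g<y

separation : ∀ lo hi → Σ ℕ λ N → ∀ {y g} → recip lo ≤ y → y < 1ℚ - recip hi → g < recip N → Separation y g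
separation lo hi = N , separate
  where
  K = proj₁ (roughDensity-vanishes (suc hi))
  ρ = roughDensity K
  ρ≤recip : ρ ≤ recip hi
  ρ≤recip = begin
    ρ                                  ≡⟨ sym (trans (cong (ρ *_) (fromℕ-suc*recip hi)) (*-identityʳ ρ)) ⟩
    ρ * (fromℕ (suc hi) * recip hi)    ≡⟨ sym (*-assoc ρ (fromℕ (suc hi)) (recip hi)) ⟩
    ρ * fromℕ (suc hi) * recip hi      ≤⟨ *-monoʳ-≤-nonNeg (recip hi) {{nonNegative (0≤recip hi)}} (proj₂ (roughDensity-vanishes (suc hi))) ⟩
    1ℚ * recip hi                      ≡⟨ *-identityˡ (recip hi) ⟩
    recip hi                           ∎
    where open ≤-Reasoning
  M = proj₁ (archimedean (roughDensity (2 ℕ.+ K)) (0<roughDensity (2 ℕ.+ K)))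
  N = multiplesMargin lo ℕ.+ mulIndex 2 M
  3g<ρ : ∀ {g} → g < recip N → g * fromℕ 3 < roughDensity (2 ℕ.+ K)
  3g<ρ {g} g<recipN = begin-strict
    g * fromℕ 3                    <⟨ *-monoˡ-<-pos (fromℕ 3) {{positive 0<3}} (<-≤-trans g<recipN (recip-antimono-≤ (ℕP.m≤n+m (mulIndex 2 M) (multiplesMargin lo)))) ⟩
    recip (mulIndex 2 M) * fromℕ 3 ≡⟨ trans (*-comm (recip (mulIndex 2 M)) (fromℕ 3)) (fromℕ-suc*recip-mulIndex 2 M) ⟩
    recip M                        <⟨ proj₂ (archimedean (roughDensity (2 ℕ.+ K)) (0<roughDensity (2 ℕ.+ K))) ⟩
    roughDensity (2 ℕ.+ K)         ∎
    where
    open ≤-Reasoning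
    0<3 : 0ℚ < fromℕ 3
    0<3 = subst (_< fromℕ 3) fromℕ-0 (fromℕ-mono-< {0} {3} (s≤s z≤n))
  separate : ∀ {y g} → recip lo ≤ y → y < 1ℚ - recip hi → g < recip N → Separation y g
  separate {y} {g} lo≤y y<1-recip g<recipN = by-cases (y <? ½)
    where
    by-cases : Dec (y < ½) → Separation y g
    by-cases (yes y<½) = multiples-separation lo lo≤y y<½ (<-≤-trans g<recipN (recip-antimono-≤ (ℕP.m≤m+n (multiplesMargin lo) (mulIndex 2 M))))
    by-cases (no  y≮½) = rough-separation K (≮⇒≥ y≮½) (<-≤-trans y<1-recip (+-monoʳ-≤ 1ℚ (neg-antimono-≤ ρ≤recip))) (3g<ρ g<recipN)

Witness : ℝ → Set
Witness α = Σ (ℕ → Bool) λ A → Σ ℝ λ dA → Σ ℝ λ dA² →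
  HasDensity (Mem A) (Mem? A) dA × HasDensity (InSq A) (InSq? A) dA² × α <ℝ dA × dA² <ℝ α

-- α <ℝ const a holds as soon as approxAbove α m < a for one m.
approxAbove : ℝ → ℕ → ℚ
approxAbove α m = seq α m + recip m + recip m

tolerance : ℕ → ℚ
tolerance m = (recip m + recip m) + (recip m + recip m)

SquareDensities⇒Witness : ∀ α {a b} → SquareDensities a b → ∀ m → approxAbove α m < a → b + tolerance m < approxAbove α m → Witness α
SquareDensities⇒Witness α {a} {b} sd m y<a b+g<y =
  A , const a , const b ,
  HasDensityᵇ⇒HasDensity (Mem? A) (λ _ → refl) A-density , HasDensityᵇ⇒HasDensity (InSq? A) A²-spec A²-density ,
  (m , subst (λ r → seq α m + r + r < a) (recip≡inv m) y<a) ,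
  (m , subst (λ r → b + r + r < seq α m) (recip≡inv m) (0<q-p⇒p<q (subst (0ℚ <_) shift (0<q-p b+g<y))))
  where
  open SquareDensities sd
  r = recip m
  shift : approxAbove α m - (b + tolerance m) ≡ seq α m - (b + r + r)
  shift = solve 3 (λ x b r → (x :+ r :+ r) :- (b :+ ((r :+ r) :+ (r :+ r))) := x :- (b :+ r :+ r)) refl (seq α m) b r

four-times : ∀ p → (p + p) + (p + p) ≡ fromℕ 4 * p
four-times p rewrite fromℕ-lit 4 = solve 1 (λ p → (p :+ p) :+ (p :+ p) := con (+ 4 / 1) :* p) refl p

window-lower : ∀ {x x₀ r₀ r} → 0ℚ + r₀ + r₀ < x₀ → x₀ ≤ x + (r₀ + r) → 0ℚ ≤ r → r₀ ≤ x + r + r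
window-lower {x} {x₀} {r₀} {r} 2r₀<x₀ x₀≤ 0≤r = 0≤q-p⇒p≤q (subst (0ℚ ≤_)
  (solve 4 (λ x x₀ r₀ r → ((x :+ (r₀ :+ r)) :- x₀ :+ (x₀ :- (con 0ℚ :+ r₀ :+ r₀))) :+ r := (x :+ r :+ r) :- r₀) refl x x₀ r₀ r)
  (0≤p+q (0≤p+q (0≤q-p x₀≤) (<⇒≤ (0<q-p 2r₀<x₀))) 0≤r))

window-upper : ∀ {x x₁ r₁ r h} → x ≤ x₁ + (r + r₁) → x₁ + r₁ + r₁ < 1ℚ → r₁ ≡ (h + h) + (h + h) → r ≤ h → x + r + r < 1ℚ - h
window-upper {x} {x₁} {r₁} {r} {h} x≤ x₁+2r₁<1 refl r≤h = 0<q-p⇒p<q (subst (0ℚ <_)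
  (solve 4 (λ x x₁ r h → ((con 1ℚ :- (x₁ :+ r₁′ h :+ r₁′ h)) :+ ((x₁ :+ (r :+ r₁′ h)) :- x)) :+ ((h :- r) :+ (h :- r) :+ (h :- r))
                         := (con 1ℚ :- h) :- (x :+ r :+ r)) refl x x₁ r h)
  (+-mono-<-≤ (+-mono-<-≤ (0<q-p x₁+2r₁<1) (0≤q-p x≤)) (0≤p+q (0≤p+q (0≤q-p r≤h) (0≤q-p r≤h)) (0≤q-p r≤h))))
  where
  r₁′ = λ h → (h :+ h) :+ (h :+ h)

approximation-window : ∀ α → 0ℝ <ℝ α → α <ℝ 1ℝ → Σ ℕ λ lo → Σ ℕ λ hi →
  ∀ N → Σ ℕ λ m → recip lo ≤ approxAbove α m × approxAbove α m < 1ℚ - recip hi × tolerance m < recip N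
approximation-window α (n₀ , 0<α₀) (n₁ , α₁<1) = n₀ , mulIndex 3 n₁ , λ N → m N , lower (m N) , upper N , small N
  where
  m : ℕ → ℕ
  m N = mulIndex 3 (n₁ ℕ.+ suc N)
  reg′ : ∀ k l → ∣ seq α k - seq α l ∣ ≤ recip k + recip l
  reg′ k l = subst₂ (λ u v → ∣ seq α k - seq α l ∣ ≤ u + v) (sym (recip≡inv k)) (sym (recip≡inv l)) (reg α k l)
  lower : ∀ k → recip n₀ ≤ approxAbove α k
  lower k = window-lower {seq α k} {seq α n₀} (subst (λ u → 0ℚ + u + u < seq α n₀) (sym (recip≡inv n₀)) 0<α₀)
                        (∣p-q∣≤r⇒p≤q+r (seq α n₀) (seq α k) (recip n₀ + recip k) (reg′ n₀ k)) (0≤recip k)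
  upper : ∀ N → approxAbove α (m N) < 1ℚ - recip (mulIndex 3 n₁)
  upper N = window-upper {seq α (m N)} {seq α n₁} (∣p-q∣≤r⇒p≤q+r (seq α (m N)) (seq α n₁) (recip (m N) + recip n₁) (reg′ (m N) n₁))
                        (subst (λ u → seq α n₁ + u + u < 1ℚ) (sym (recip≡inv n₁)) α₁<1)
                        (trans (sym (fromℕ-suc*recip-mulIndex 3 n₁)) (sym (four-times (recip (mulIndex 3 n₁)))))
                        (recip-antimono-≤ (mulIndex-mono {3} ℕP.≤-refl (ℕP.m≤m+n n₁ (suc N))))
  small : ∀ N → tolerance (m N) < recip N
  small N = begin-strict
    tolerance (m N)            ≡⟨ four-times (recip (m N)) ⟩
    fromℕ 4 * recip (m N)      ≡⟨ fromℕ-suc*recip-mulIndex 3 (n₁ ℕ.+ suc N) ⟩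
    recip (n₁ ℕ.+ suc N)       <⟨ recip-antimono-< (ℕP.m≤n+m (suc N) n₁) ⟩
    recip N                    ∎
    where open ≤-Reasoning

mainTheorem4 : (α : ℝ) → 0ℝ <ℝ α → α <ℝ 1ℝ →
    Σ (ℕ → Bool) λ A →
      Σ ℝ λ dA → Σ ℝ λ dA² →
        HasDensity (Mem A) (Mem? A) dA × HasDensity (InSq A) (InSq? A) dA² ×
        α <ℝ dA × dA² <ℝ α
mainTheorem4 α 0<α α<1 =
  let lo , hi , window = approximation-window α 0<α α<1
      N , separate = separation lo hi
      m , lo≤y , y<hi , g<N = window N
      a , b , squareDensities , y<a , b+g<y = separate lo≤y y<hi g<N
  in SquareDensities⇒Witness α squareDensities m y<a b+g<y
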